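{- Let $a,b,c\ge 0$ be integers with $\gcd(a,b,c)=1$ such that the list $M$ consisting of $a$ copies of $(1,0)^T$, $b$ copies of $(0,1)^T$ and $c$ copies of $(1,1)^T$ generates $\mathbb{F}_2^2$, and let $G=G(\mathbb{F}_2^2,M)$. Then \[\operatorname{Syl}_2K(G)\cong\begin{cases}\mathbb{Z}/2^{v_2(b+c)+1}\mathbb{Z} & a\text{ odd},\ b,c\text{ even},\\ \mathbb{Z}/2^{v_2(a+b)+1}\mathbb{Z} & a,b\text{ odd},\ c\text{ even},\\ \mathbb{Z}/2^{e}\mathbb{Z}\times\mathbb{Z}/2^{f}\mathbb{Z} & a,b,c\text{ odd},\end{cases}\] where $f=\max(v_2(a+b),v_2(b+c),v_2(a+c))+1$ and $e=v_2(|K(G)|)-f$.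
   Context: $G(\mathbb{F}_2^r,M)$ is the Cayley multigraph with vertex set $\mathbb{F}_2^r$ and one edge between $w$ and $w+v$ for each vertex $w$ and each entry $v$ of the list $M$. $K(G)$ is its sandpile group, the torsion subgroup of the cokernel over $\mathbb{Z}$ of its Laplacian, and $\operatorname{Syl}_2K(G)$ its Sylow-$2$ subgroup. $v_2$ is the $2$-adic valuation. -}

module Defs where

open import Data.Bool using (Bool; true; false; _xor_; if_then_else_)
open import Data.Product using (Σ; ∃; _×_; _,_)
open import Data.Nat as ℕ using (ℕ; zero; suc; _∸_; _%_; _/_; _^_)
open import Data.Integer as ℤ using (ℤ; +_; _-_; _+_; _*_; 0ℤ)
open import Data.Integer.Divisibility using () renaming (_∣_ to _∣ℤ_)
open import Data.List using (List; []; _∷_; length; replicate; _++_)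
open import Data.Fin using (Fin)
open import Data.Vec using (Vec; lookup)
open import Relation.Binary.PropositionalEquality using (_≡_)

V : Set
V = Bool × Bool

_⊕_ : V → V → V
(x₁ , x₂) ⊕ (y₁ , y₂) = (x₁ xor y₁ , x₂ xor y₂)

0V : V
0V = (false , false)

lincomb : List Bool → List V → V
lincomb (true  ∷ s) (v ∷ M) = v ⊕ lincomb s M
lincomb (false ∷ s) (v ∷ M) = lincomb s M
lincomb _ _ = 0V

-- M generates F_2^2 (over F_2, spans = generates as a group).
Generates : List V → Set
Generates M = (w : V) → Σ (List Bool) λ s → (length s ≡ length M) × (lincomb s M ≡ w)

Mabc : ℕ → ℕ → ℕ → List V
Mabc a b c = replicate a (true , false) ++ replicate b (false , true) ++ replicate c (true , true)

-- Laplacian of the Cayley multigraph G(F_2^2, M), acting on ℤ^V.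
-- Adjacency A[w][u] = #{ entries v of M : w + v = u }, degree = length M,
-- so (L z)(w) = Σ_{v ∈ M} (z w - z (w + v)).

ZV : Set
ZV = V → ℤ

lap : List V → ZV → ZV
lap [] z w = 0ℤ
lap (v ∷ M) z w = (z w - z (w ⊕ v)) + lap M z w

InImL : List V → ZV → Set
InImL M x = ∃ λ (z : ZV) → (w : V) → x w ≡ lap M z w

_≈[_]_ : ZV → List V → ZV → Set
x ≈[ M ] y = InImL M (λ w → x w - y w)

_+V_ : ZV → ZV → ZV
(x +V y) w = x w + y w

_·V_ : ℕ → ZV → ZV
(n ·V x) w = (+ n) * x w

-- Sandpile group K(G): torsion elements of the cokernel.
InK : List V → ZV → Set
InK M x = ∃ λ (n : ℕ) → (n ℕ.≥ 1) × InImL M (n ·V x)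

InSyl2 : List V → ZV → Set
InSyl2 M x = ∃ λ (k : ℕ) → InImL M ((2 ^ k) ·V x)

CardK : List V → ℕ → Set
CardK M N = Σ (Fin N → ZV) λ g →
    ((i : Fin N) → InK M (g i))
  × ((i j : Fin N) → g i ≈[ M ] g j → i ≡ j)
  × ((x : ZV) → InK M x → ∃ λ (i : Fin N) → g i ≈[ M ] x)

-- Products of cyclic groups ℤ/m₁ × … × ℤ/mₙ, as ℤ^n with componentwise
-- congruence.

_≡mod[_]_ : {n : ℕ} → (Fin n → ℤ) → Vec ℕ n → (Fin n → ℤ) → Set
s ≡mod[ ms ] t = ∀ i → (+ lookup ms i) ∣ℤ (s i - t i)

record Syl2Iso (M : List V) {n : ℕ} (ms : Vec ℕ n) : Set where
  field
    φ    : (x : ZV) → InSyl2 M x → Fin n → ℤ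
    wd   : ∀ x y px py → x ≈[ M ] y → φ x px ≡mod[ ms ] φ y py
    hom  : ∀ x y px py pxy →
             φ (x +V y) pxy ≡mod[ ms ] (λ i → φ x px i + φ y py i)
    inj  : ∀ x y px py → φ x px ≡mod[ ms ] φ y py → x ≈[ M ] y
    surj : (t : Fin n → ℤ) → ∃ λ x → Σ (InSyl2 M x) λ px → φ x px ≡mod[ ms ] t

-- 2-adic valuation of a positive natural number (v₂ 0 = 0 by convention;
-- never used at 0 in the theorem).

v2aux : ℕ → ℕ → ℕ
v2aux zero n = 0
v2aux (suc k) zero = 0
v2aux (suc k) (suc n) with suc n % 2
... | zero = suc (v2aux k (suc n / 2))
... | suc _ = 0

v₂ : ℕ → ℕ
v₂ n = v2aux n n

-- Write Q₁, Q₂, Q₃ for the sums of x : ℤ^𝔽₂² over the complements of the three lines of 𝔽₂², and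
-- α = a + c, β = b + c, γ = a + b.  The Laplacian satisfies Qᵢ (L z) = αᵢ (2 Qᵢ z − Σ z), so x lies in its
-- image iff Σ x = 0 and (Q₁, Q₂, Q₃) x lies in Λ(α, β, γ) = {(α (p + 2u₁), β (p + 2u₂), γ (p + 2u₃))}.
-- Hence K(G) ≅ {q ∈ ℤ³ : q₁ + q₂ + q₃ even} / Λ(α, β, γ), a group of order α · 2β · γ.  Dividing each Qᵢ
-- by the odd part of αᵢ identifies the Sylow 2-subgroup with the same quotient for the 2-parts 2^A, 2^B,
-- 2^C, and explicit linear forms show this quotient to be ℤ/2^(B+1) when A = C = 0, and
-- ℤ/2^(X+1) × ℤ/2^(Y+1) when the exponents are X, Y, 1 with X, Y both 1 or both larger.  For a, b, c odd
-- the halves of α, β, γ add up to the odd number a + b + c, so an odd number of the exponents equal 1,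
-- and a permutation brings them into the second shape.

module Submission where

open import Defs

module Parity where

  open import Data.Nat
  open import Data.Nat.Properties
  open import Data.Nat.DivMod
  open import Data.Nat.Induction using (<-rec)
  open import Data.Nat.Tactic.RingSolver using (solve-∀)
  open import Data.Product using (∃; ∃₂; _,_)
  open import Data.Sum using (_⊎_; inj₁; inj₂)
  open import Data.Empty using (⊥-elim)
  open import Relation.Binary.PropositionalEquality

  Odd Even : ℕ → Set
  Odd n = ∃ λ h → n ≡ suc (h + h)
  Even n = ∃ λ h → n ≡ h + h

  even⊎odd : ∀ n → Even n ⊎ Odd n
  even⊎odd zero = inj₁ (0 , refl)
  even⊎odd (suc n) with even⊎odd n
  ... | inj₁ (h , e) = inj₂ (h , cong suc e)
  ... | inj₂ (h , e) = inj₁ (suc h , cong suc (trans e (sym (+-suc h h))))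

  even≢odd′ : ∀ m n → m + m ≢ suc (n + n)
  even≢odd′ m n e = even≢odd m n (trans (twice m) (trans e (cong suc (sym (twice n)))))
    where
    twice : ∀ m → 2 * m ≡ m + m
    twice = solve-∀

  odd+even : ∀ {m n} → Odd m → Even n → Odd (m + n)
  odd+even (h , refl) (g , refl) = h + g , lemma h g
    where
    lemma : ∀ h g → suc (h + h) + (g + g) ≡ suc ((h + g) + (h + g))
    lemma = solve-∀

  even+even : ∀ {m n} → Even m → Even n → Even (m + n)
  even+even (h , refl) (g , refl) = h + g , lemma h g
    where
    lemma : ∀ h g → (h + h) + (g + g) ≡ (h + g) + (h + g)
    lemma = solve-∀

  odd+odd : ∀ {m n} → Odd m → Odd n → Even (m + n)
  odd+odd (h , refl) (g , refl) = suc (h + g) , lemma h g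
    where
    lemma : ∀ h g → suc (h + h) + suc (g + g) ≡ suc (h + g) + suc (h + g)
    lemma = solve-∀

  odd⇒nonZero+ : ∀ {m n} → Odd m → NonZero (m + n)
  odd⇒nonZero+ (h , refl) = _

  %2≡1⇒odd : ∀ n → n % 2 ≡ 1 → Odd n
  %2≡1⇒odd n e = n / 2 , trans (m≡m%n+[m/n]*n n 2) (trans (cong (_+ n / 2 * 2) e) (lemma (n / 2)))
    where
    lemma : ∀ q → 1 + q * 2 ≡ suc (q + q)
    lemma = solve-∀

  %2≡0⇒even : ∀ n → n % 2 ≡ 0 → Even n
  %2≡0⇒even n e = n / 2 , trans (m≡m%n+[m/n]*n n 2) (trans (cong (_+ n / 2 * 2) e) (lemma (n / 2)))
    where
    lemma : ∀ q → 0 + q * 2 ≡ q + q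
    lemma = solve-∀

  odd%2≡1 : ∀ h → suc (h + h) % 2 ≡ 1
  odd%2≡1 h = trans (cong (_% 2) (lemma h)) ([m+kn]%n≡m%n 1 h 2)
    where
    lemma : ∀ h → suc (h + h) ≡ 1 + h * 2
    lemma = solve-∀

  %2-cong-+ : ∀ m m′ n n′ → m % 2 ≡ m′ % 2 → n % 2 ≡ n′ % 2 → (m + n) % 2 ≡ (m′ + n′) % 2
  %2-cong-+ m m′ n n′ e f =
    trans (%-distribˡ-+ m n 2) (trans (cong₂ (λ u v → (u + v) % 2) e f) (sym (%-distribˡ-+ m′ n′ 2)))

  pow2Parity : ℕ → ℕ
  pow2Parity zero = 1
  pow2Parity (suc _) = 0

  2^k*odd%2 : ∀ k h → (2 ^ k * suc (h + h)) % 2 ≡ pow2Parity k % 2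
  2^k*odd%2 zero h = trans (cong (_% 2) (*-identityˡ (suc (h + h)))) (odd%2≡1 h)
  2^k*odd%2 (suc k) h = trans (cong (_% 2) (lemma (2 ^ k) (suc (h + h)))) (m*n%n≡0 (2 ^ k * suc (h + h)) 2)
    where
    lemma : ∀ p o → 2 * p * o ≡ p * o * 2
    lemma = solve-∀

  2-adic : ∀ n → ∃₂ λ k h → suc n ≡ 2 ^ k * suc (h + h)
  2-adic = <-rec _ step
    where
    step : ∀ n → (∀ {m} → m < n → ∃₂ λ k h → suc m ≡ 2 ^ k * suc (h + h)) →
           ∃₂ λ k h → suc n ≡ 2 ^ k * suc (h + h)
    step n rec with even⊎odd (suc n)
    ... | inj₂ (h , e) = 0 , h , trans e (sym (*-identityˡ _))
    ... | inj₁ (suc m , e) with rec m<n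
      where
      m<n : m < n
      m<n = s≤s⁻¹ (subst (suc (suc m) ≤_) (sym e) (s≤s (m≤n+m (suc m) m)))
    ...   | k , h , e′ = suc k , h , trans e (trans (cong₂ _+_ e′ e′) (lemma (2 ^ k) (suc (h + h))))
      where
      lemma : ∀ p o → p * o + p * o ≡ 2 * p * o
      lemma = solve-∀

  2^k*odd≢0 : ∀ k h → 2 ^ k * suc (h + h) ≢ 0
  2^k*odd≢0 k h e with m*n≡0⇒m≡0∨n≡0 (2 ^ k) e
  ... | inj₁ e′ = 1+n≢0 (m^n≡0⇒m≡0 2 k e′)

  private
    v2aux-odd : ∀ f n → suc n % 2 ≡ 1 → v2aux (suc f) (suc n) ≡ 0
    v2aux-odd f n e with suc n % 2
    ... | suc _ = refl

    v2aux-even : ∀ f n → suc n % 2 ≡ 0 → v2aux (suc f) (suc n) ≡ suc (v2aux f (suc n / 2))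
    v2aux-even f n e with suc n % 2
    ... | zero = refl

  -- The first argument of v2aux is fuel; it suffices once it bounds the second.
  v2aux-2^k*odd : ∀ f k h → 2 ^ k * suc (h + h) ≤ f → v2aux f (2 ^ k * suc (h + h)) ≡ k
  v2aux-2^k*odd zero k h le = ⊥-elim (2^k*odd≢0 k h (n≤0⇒n≡0 le))
  v2aux-2^k*odd (suc f) zero h le =
    trans (cong (v2aux (suc f)) (*-identityˡ (suc (h + h)))) (v2aux-odd f (h + h) (odd%2≡1 h))
  v2aux-2^k*odd (suc f) (suc k) h le = begin
    v2aux (suc f) (2 ^ suc k * o)            ≡⟨ cong (v2aux (suc f)) M*2 ⟩
    v2aux (suc f) (suc m * 2)                ≡⟨ v2aux-even f (suc (m * 2)) (m*n%n≡0 (suc m) 2) ⟩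
    suc (v2aux f (suc m * 2 / 2))            ≡⟨ cong (λ x → suc (v2aux f x)) (trans (m*n/n≡m (suc m) 2) (sym M≡1+m)) ⟩
    suc (v2aux f (2 ^ k * o))                ≡⟨ cong suc (v2aux-2^k*odd f k h M≤f) ⟩
    suc k                                    ∎
    where
    open ≡-Reasoning
    o : ℕ
    o = suc (h + h)
    m : ℕ
    m = pred (2 ^ k * o)
    M≡1+m : 2 ^ k * o ≡ suc m
    M≡1+m = sym (suc-pred (2 ^ k * o) {{≢-nonZero (2^k*odd≢0 k h)}})
    lemma : ∀ p o → 2 * p * o ≡ p * o * 2
    lemma = solve-∀
    M*2 : 2 ^ suc k * o ≡ suc m * 2
    M*2 = trans (lemma (2 ^ k) o) (cong (_* 2) M≡1+m)
    M≤f : 2 ^ k * o ≤ f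
    M≤f = subst (_≤ f) (sym M≡1+m) (≤-trans (s≤s (m≤m*n m 2)) (s≤s⁻¹ (subst (_≤ suc f) M*2 le)))

  v₂-2^k*odd : ∀ k h → v₂ (2 ^ k * suc (h + h)) ≡ k
  v₂-2^k*odd k h = v2aux-2^k*odd (2 ^ k * suc (h + h)) k h ≤-refl

  infix 4 _≡2^_*odd
  record _≡2^_*odd (n k : ℕ) : Set where
    constructor _,_
    field
      half-odd : ℕ
      equation : n ≡ 2 ^ k * suc (half-odd + half-odd)

  v₂-≡2^*odd : ∀ {n k} → n ≡2^ k *odd → v₂ n ≡ k
  v₂-≡2^*odd {k = k} (h , refl) = v₂-2^k*odd k h

  odd⇒≡2^0*odd : ∀ {n} → Odd n → n ≡2^ 0 *odd
  odd⇒≡2^0*odd (h , e) = h , trans e (sym (*-identityˡ _))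

  even⇒≡2^suc*odd : ∀ {n} .{{_ : NonZero n}} → Even n → ∃ λ k → n ≡2^ suc k *odd
  even⇒≡2^suc*odd {zero} {{()}}
  even⇒≡2^suc*odd {suc n} (m , e) with 2-adic n
  ... | zero , h , e′ = ⊥-elim (even≢odd′ m h (trans (sym e) (trans e′ (*-identityˡ _))))
  ... | suc k , h , e′ = k , h , e′

  *-≡2^*odd : ∀ {m n i j} → m ≡2^ i *odd → n ≡2^ j *odd → m * n ≡2^ i + j *odd
  *-≡2^*odd {i = i} {j} (h , refl) (g , refl) = h′ , (begin
    2 ^ i * suc (h + h) * (2 ^ j * suc (g + g))   ≡⟨ [m*n]*[o*p]≡[m*o]*[n*p] (2 ^ i) (suc (h + h)) (2 ^ j) (suc (g + g)) ⟩
    2 ^ i * 2 ^ j * (suc (h + h) * suc (g + g))   ≡⟨ cong₂ _*_ (^-distribˡ-+-* 2 i j) odd*odd ⟨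
    2 ^ (i + j) * suc (h′ + h′)                   ∎)
    where
    open ≡-Reasoning
    h′ : ℕ
    h′ = h + g + 2 * (h * g)
    lemma : ∀ h g → suc ((h + g + 2 * (h * g)) + (h + g + 2 * (h * g))) ≡ suc (h + h) * suc (g + g)
    lemma = solve-∀
    odd*odd : suc (h′ + h′) ≡ suc (h + h) * suc (g + g)
    odd*odd = lemma h g

  2*-≡2^*odd : ∀ {n j} → n ≡2^ j *odd → 2 * n ≡2^ suc j *odd
  2*-≡2^*odd {j = j} (h , refl) = h , sym (*-assoc 2 (2 ^ j) (suc (h + h)))

open Parity

module Image where

  open import Data.Bool using (true; false)
  open import Data.Nat as ℕ using (ℕ; zero; suc)
  open import Data.Integer using (ℤ; +_; _+_; _-_; _*_; -_; 0ℤ; 1ℤ)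
  open import Data.Integer.Properties
  open import Data.Integer.Tactic.RingSolver using (solve-∀)
  open import Data.List using (List; []; _∷_; _++_; replicate)
  open import Data.Product using (Σ; _×_; _,_)
  open import Relation.Binary.PropositionalEquality

  v₀₀ v₁₀ v₀₁ v₁₁ : V
  v₀₀ = false , false
  v₁₀ = true , false
  v₀₁ = false , true
  v₁₁ = true , true

  two : ℤ
  two = + 2

  lap-++ : ∀ M N z w → lap (M ++ N) z w ≡ lap M z w + lap N z w
  lap-++ [] N z w = sym (+-identityˡ _)
  lap-++ (v ∷ M) N z w = trans (cong (λ t → z w - z (w ⊕ v) + t) (lap-++ M N z w))
                               (sym (+-assoc (z w - z (w ⊕ v)) (lap M z w) (lap N z w)))

  lap-replicate : ∀ n v z w → lap (replicate n v) z w ≡ + n * (z w - z (w ⊕ v))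
  lap-replicate zero v z w = sym (*-zeroˡ (z w - z (w ⊕ v)))
  lap-replicate (suc n) v z w = trans (cong (λ t → z w - z (w ⊕ v) + t) (lap-replicate n v z w)) (lemma (z w - z (w ⊕ v)) (+ n))
    where
    lemma : ∀ d m → d + m * d ≡ (1ℤ + m) * d
    lemma = solve-∀

  L : ℕ → ℕ → ℕ → ZV → ZV
  L a b c z w = + a * (z w - z (w ⊕ v₁₀)) + (+ b * (z w - z (w ⊕ v₀₁)) + + c * (z w - z (w ⊕ v₁₁)))

  lap-Mabc : ∀ a b c z w → lap (Mabc a b c) z w ≡ L a b c z w
  lap-Mabc a b c z w = trans (lap-++ (replicate a v₁₀) _ z w)
    (cong₂ _+_ (lap-replicate a v₁₀ z w)
               (trans (lap-++ (replicate b v₀₁) _ z w) (cong₂ _+_ (lap-replicate b v₀₁ z w) (lap-replicate c v₁₁ z w))))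

  sumOver : List V → ZV → ℤ
  sumOver [] x = 0ℤ
  sumOver (v ∷ vs) x = x v + sumOver vs x

  allV coset₁ coset₂ coset₃ : List V
  allV = v₀₀ ∷ v₁₀ ∷ v₀₁ ∷ v₁₁ ∷ []
  coset₁ = v₁₀ ∷ v₁₁ ∷ []
  coset₂ = v₀₁ ∷ v₁₁ ∷ []
  coset₃ = v₁₀ ∷ v₀₁ ∷ []

  total Q₁ Q₂ Q₃ : ZV → ℤ
  total = sumOver allV
  Q₁ = sumOver coset₁
  Q₂ = sumOver coset₂
  Q₃ = sumOver coset₃

  sumOver-cong : ∀ vs {x y} → x ≗ y → sumOver vs x ≡ sumOver vs y
  sumOver-cong [] e = refl
  sumOver-cong (v ∷ vs) e = cong₂ _+_ (e v) (sumOver-cong vs e)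

  sumOver-+ : ∀ vs x y → sumOver vs (x +V y) ≡ sumOver vs x + sumOver vs y
  sumOver-+ [] x y = refl
  sumOver-+ (v ∷ vs) x y = trans (cong (λ t → x v + y v + t) (sumOver-+ vs x y)) (lemma (x v) (y v) _ _)
    where
    lemma : ∀ a b c d → a + b + (c + d) ≡ a + c + (b + d)
    lemma = solve-∀

  sumOver-diff : ∀ vs x y → sumOver vs (λ w → x w - y w) ≡ sumOver vs x - sumOver vs y
  sumOver-diff [] x y = refl
  sumOver-diff (v ∷ vs) x y = trans (cong (λ t → x v - y v + t) (sumOver-diff vs x y)) (lemma (x v) (y v) _ _)
    where
    lemma : ∀ a b c d → a - b + (c - d) ≡ a + c - (b + d)
    lemma = solve-∀

  sumOver-· : ∀ vs n x → sumOver vs (n ·V x) ≡ + n * sumOver vs x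
  sumOver-· [] n x = sym (*-zeroʳ (+ n))
  sumOver-· (v ∷ vs) n x = trans (cong (λ t → + n * x v + t) (sumOver-· vs n x)) (sym (*-distribˡ-+ (+ n) (x v) _))

  twice-at : V → ℤ → ℤ → ℤ → ℤ → ℤ
  twice-at (false , false) t q₁ q₂ q₃ = two * t - (q₁ + q₂ + q₃)
  twice-at (true  , false) t q₁ q₂ q₃ = q₁ + q₃ - q₂
  twice-at (false , true)  t q₁ q₂ q₃ = q₂ + q₃ - q₁
  twice-at (true  , true)  t q₁ q₂ q₃ = q₁ + q₂ - q₃

  two*-at : ∀ x w → two * x w ≡ twice-at w (total x) (Q₁ x) (Q₂ x) (Q₃ x)
  two*-at x (false , false) = at₀₀ (x v₀₀) (x v₁₀) (x v₀₁) (x v₁₁)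
    where
    at₀₀ : ∀ x₀ x₁ x₂ x₃ → two * x₀ ≡ two * (x₀ + (x₁ + (x₂ + (x₃ + 0ℤ)))) - ((x₁ + (x₃ + 0ℤ)) + (x₂ + (x₃ + 0ℤ)) + (x₁ + (x₂ + 0ℤ)))
    at₀₀ = solve-∀
  two*-at x (true , false) = at₁₀ (x v₁₀) (x v₀₁) (x v₁₁)
    where
    at₁₀ : ∀ x₁ x₂ x₃ → two * x₁ ≡ (x₁ + (x₃ + 0ℤ)) + (x₁ + (x₂ + 0ℤ)) - (x₂ + (x₃ + 0ℤ))
    at₁₀ = solve-∀
  two*-at x (false , true) = at₀₁ (x v₁₀) (x v₀₁) (x v₁₁)
    where
    at₀₁ : ∀ x₁ x₂ x₃ → two * x₂ ≡ (x₂ + (x₃ + 0ℤ)) + (x₁ + (x₂ + 0ℤ)) - (x₁ + (x₃ + 0ℤ))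
    at₀₁ = solve-∀
  two*-at x (true , true) = at₁₁ (x v₁₀) (x v₀₁) (x v₁₁)
    where
    at₁₁ : ∀ x₁ x₂ x₃ → two * x₃ ≡ (x₁ + (x₃ + 0ℤ)) + (x₂ + (x₃ + 0ℤ)) - (x₁ + (x₂ + 0ℤ))
    at₁₁ = solve-∀

  ≗-from-sums : ∀ x y → total x ≡ total y → Q₁ x ≡ Q₁ y → Q₂ x ≡ Q₂ y → Q₃ x ≡ Q₃ y → x ≗ y
  ≗-from-sums x y t q₁ q₂ q₃ w = *-cancelˡ-≡ two (x w) (y w) (begin
    two * x w                                     ≡⟨ two*-at x w ⟩
    twice-at w (total x) (Q₁ x) (Q₂ x) (Q₃ x)     ≡⟨ cong₂ (λ s r → twice-at w s r (Q₂ x) (Q₃ x)) t q₁ ⟩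
    twice-at w (total y) (Q₁ y) (Q₂ x) (Q₃ x)     ≡⟨ cong₂ (twice-at w (total y) (Q₁ y)) q₂ q₃ ⟩
    twice-at w (total y) (Q₁ y) (Q₂ y) (Q₃ y)     ≡⟨ two*-at y w ⟨
    two * y w                                     ∎)
    where open ≡-Reasoning

  realise : ∀ q₁ q₂ q₃ h → q₁ + q₂ + q₃ ≡ h + h →
            Σ ZV λ x → (total x ≡ 0ℤ) × (Q₁ x ≡ q₁) × (Q₂ x ≡ q₂) × (Q₃ x ≡ q₃)
  realise q₁ q₂ q₃ h e = x , total≡0 q₁ q₂ q₃ h , Q₁≡ q₁ q₃ h , Q₂≡ q₂ q₃ h , Q₃≡
    where
    x : ZV
    x (false , false) = - (q₁ + q₂ - (h - q₃))
    x (true  , false) = q₁ - (h - q₃)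
    x (false , true)  = q₂ - (h - q₃)
    x (true  , true)  = h - q₃
    total≡0 : ∀ q₁ q₂ q₃ h → - (q₁ + q₂ - (h - q₃)) + ((q₁ - (h - q₃)) + ((q₂ - (h - q₃)) + ((h - q₃) + 0ℤ))) ≡ 0ℤ
    total≡0 = solve-∀
    Q₁≡ : ∀ q₁ q₃ h → q₁ - (h - q₃) + (h - q₃ + 0ℤ) ≡ q₁
    Q₁≡ = solve-∀
    Q₂≡ : ∀ q₂ q₃ h → q₂ - (h - q₃) + (h - q₃ + 0ℤ) ≡ q₂
    Q₂≡ = solve-∀
    Q₃≡ : q₁ - (h - q₃) + (q₂ - (h - q₃) + 0ℤ) ≡ q₃
    Q₃≡ = begin
      q₁ - (h - q₃) + (q₂ - (h - q₃) + 0ℤ) ≡⟨ lemma q₁ q₂ q₃ h ⟩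
      (q₁ + q₂ + q₃) - (h + h) + q₃   ≡⟨ cong (λ v → v - (h + h) + q₃) e ⟩
      (h + h) - (h + h) + q₃          ≡⟨ lemma′ h q₃ ⟩
      q₃                              ∎
      where
      open ≡-Reasoning
      lemma : ∀ q₁ q₂ q₃ h → q₁ - (h - q₃) + (q₂ - (h - q₃) + 0ℤ) ≡ (q₁ + q₂ + q₃) - (h + h) + q₃
      lemma = solve-∀
      lemma′ : ∀ h q₃ → (h + h) - (h + h) + q₃ ≡ q₃
      lemma′ = solve-∀

  α β γ : ℕ → ℕ → ℕ → ℤ
  α a b c = + (a ℕ.+ c)
  β a b c = + (b ℕ.+ c)
  γ a b c = + (a ℕ.+ b)

  InLattice : ℤ → ℤ → ℤ → ℤ → ℤ → ℤ → Set
  InLattice α β γ r₁ r₂ r₃ = Σ ℤ λ p → Σ ℤ λ u₁ → Σ ℤ λ u₂ → Σ ℤ λ u₃ →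
    (r₁ ≡ α * (p + two * u₁)) × (r₂ ≡ β * (p + two * u₂)) × (r₃ ≡ γ * (p + two * u₃))

  InLattice-≡ : ∀ α β γ {r₁ r₂ r₃ s₁ s₂ s₃} → r₁ ≡ s₁ → r₂ ≡ s₂ → r₃ ≡ s₃ →
                InLattice α β γ r₁ r₂ r₃ → InLattice α β γ s₁ s₂ s₃
  InLattice-≡ _ _ _ refl refl refl l = l

  module _ (a b c : ℕ) (z : ZV) where

    private
      z₀ z₁ z₂ z₃ : ℤ
      z₀ = z v₀₀
      z₁ = z v₁₀
      z₂ = z v₀₁
      z₃ = z v₁₁

    total-L : total (L a b c z) ≡ 0ℤ
    total-L = lemma (+ a) (+ b) (+ c) z₀ z₁ z₂ z₃
      where
      lemma : ∀ A B C z₀ z₁ z₂ z₃ →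
        A * (z₀ - z₁) + (B * (z₀ - z₂) + C * (z₀ - z₃)) + ((A * (z₁ - z₀) + (B * (z₁ - z₃) + C * (z₁ - z₂)))
        + ((A * (z₂ - z₃) + (B * (z₂ - z₀) + C * (z₂ - z₁))) + ((A * (z₃ - z₂) + (B * (z₃ - z₁) + C * (z₃ - z₀))) + 0ℤ))) ≡ 0ℤ
      lemma = solve-∀

    Q₁-L : Q₁ (L a b c z) ≡ α a b c * (z₁ + z₃ - z₀ - z₂)
    Q₁-L = trans (lemma (+ a) (+ b) (+ c) z₀ z₁ z₂ z₃) (cong (_* (z₁ + z₃ - z₀ - z₂)) (sym (pos-+ a c)))
      where
      lemma : ∀ A B C z₀ z₁ z₂ z₃ →
        A * (z₁ - z₀) + (B * (z₁ - z₃) + C * (z₁ - z₂)) + ((A * (z₃ - z₂) + (B * (z₃ - z₁) + C * (z₃ - z₀))) + 0ℤ)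
        ≡ (A + C) * (z₁ + z₃ - z₀ - z₂)
      lemma = solve-∀

    Q₂-L : Q₂ (L a b c z) ≡ β a b c * (z₁ + z₃ - z₀ - z₂ + two * (z₂ - z₁))
    Q₂-L = trans (lemma (+ a) (+ b) (+ c) z₀ z₁ z₂ z₃) (cong (_* (z₁ + z₃ - z₀ - z₂ + two * (z₂ - z₁))) (sym (pos-+ b c)))
      where
      lemma : ∀ A B C z₀ z₁ z₂ z₃ →
        A * (z₂ - z₃) + (B * (z₂ - z₀) + C * (z₂ - z₁)) + ((A * (z₃ - z₂) + (B * (z₃ - z₁) + C * (z₃ - z₀))) + 0ℤ)
        ≡ (B + C) * (z₁ + z₃ - z₀ - z₂ + two * (z₂ - z₁))
      lemma = solve-∀

    Q₃-L : Q₃ (L a b c z) ≡ γ a b c * (z₁ + z₃ - z₀ - z₂ + two * (z₂ - z₃))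
    Q₃-L = trans (lemma (+ a) (+ b) (+ c) z₀ z₁ z₂ z₃) (cong (_* (z₁ + z₃ - z₀ - z₂ + two * (z₂ - z₃))) (sym (pos-+ a b)))
      where
      lemma : ∀ A B C z₀ z₁ z₂ z₃ →
        A * (z₁ - z₀) + (B * (z₁ - z₃) + C * (z₁ - z₂)) + ((A * (z₂ - z₃) + (B * (z₂ - z₀) + C * (z₂ - z₁))) + 0ℤ)
        ≡ (A + B) * (z₁ + z₃ - z₀ - z₂ + two * (z₂ - z₃))
      lemma = solve-∀

  module _ (a b c : ℕ) where

    InImL⇒lattice : ∀ d → InImL (Mabc a b c) d →
                    total d ≡ 0ℤ × InLattice (α a b c) (β a b c) (γ a b c) (Q₁ d) (Q₂ d) (Q₃ d)
    InImL⇒lattice d (z , eq) =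
      trans (sumOver-cong allV d≗Lz) (total-L a b c z) ,
      z₁ + z₃ - z₀ - z₂ , 0ℤ , z₂ - z₁ , z₂ - z₃ ,
      trans (sumOver-cong coset₁ d≗Lz) (trans (Q₁-L a b c z) (cong (α a b c *_) (sym (+-identityʳ _)))) ,
      trans (sumOver-cong coset₂ d≗Lz) (Q₂-L a b c z) ,
      trans (sumOver-cong coset₃ d≗Lz) (Q₃-L a b c z)
      where
      z₀ = z v₀₀
      z₁ = z v₁₀
      z₂ = z v₀₁
      z₃ = z v₁₁
      d≗Lz : d ≗ L a b c z
      d≗Lz w = trans (eq w) (lap-Mabc a b c z w)

    lattice⇒InImL : ∀ d → total d ≡ 0ℤ → InLattice (α a b c) (β a b c) (γ a b c) (Q₁ d) (Q₂ d) (Q₃ d) →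
                    InImL (Mabc a b c) d
    lattice⇒InImL d t₀ (p , u₁ , u₂ , u₃ , e₁ , e₂ , e₃) =
      z , λ w → trans (≗-from-sums d (L a b c z) t q₁ q₂ q₃ w) (sym (lap-Mabc a b c z w))
      where
      z : ZV
      z (false , false) = 0ℤ
      z (true  , false) = p + u₁ + u₃
      z (false , true)  = p + u₂ + u₃
      z (true  , true)  = p + u₁ + u₂
      base : ∀ p u₁ u₂ u₃ → p + u₁ + u₃ + (p + u₁ + u₂) - 0ℤ - (p + u₂ + u₃) ≡ p + two * u₁
      base = solve-∀
      shift₂ : ∀ p u₁ u₂ u₃ → p + u₁ + u₃ + (p + u₁ + u₂) - 0ℤ - (p + u₂ + u₃) + two * (p + u₂ + u₃ - (p + u₁ + u₃)) ≡ p + two * u₂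
      shift₂ = solve-∀
      shift₃ : ∀ p u₁ u₂ u₃ → p + u₁ + u₃ + (p + u₁ + u₂) - 0ℤ - (p + u₂ + u₃) + two * (p + u₂ + u₃ - (p + u₁ + u₂)) ≡ p + two * u₃
      shift₃ = solve-∀
      t : total d ≡ total (L a b c z)
      t = trans t₀ (sym (total-L a b c z))
      q₁ : Q₁ d ≡ Q₁ (L a b c z)
      q₁ = trans e₁ (sym (trans (Q₁-L a b c z) (cong (α a b c *_) (base p u₁ u₂ u₃))))
      q₂ : Q₂ d ≡ Q₂ (L a b c z)
      q₂ = trans e₂ (sym (trans (Q₂-L a b c z) (cong (β a b c *_) (shift₂ p u₁ u₂ u₃))))
      q₃ : Q₃ d ≡ Q₃ (L a b c z)
      q₃ = trans e₃ (sym (trans (Q₃-L a b c z) (cong (γ a b c *_) (shift₃ p u₁ u₂ u₃))))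

open Image

module Presentations where

  open import Data.Nat as ℕ using (ℕ; zero; suc)
  import Data.Nat.Properties as ℕ
  open import Data.Integer using (ℤ; +_; _+_; _-_; _*_; -_; 0ℤ; 1ℤ)
  open import Data.Integer.Properties
  open import Data.Integer.Tactic.RingSolver using (solve-∀)
  open import Data.Integer.Divisibility.Signed using (_∣_; divides)
  open import Data.Fin using (Fin; zero; suc)
  open import Data.Vec using (Vec; lookup; []; _∷_)
  open import Data.Product using (Σ; _×_; _,_; proj₁; proj₂)
  open import Relation.Binary.PropositionalEquality

  pow₂ : ℕ → ℤ
  pow₂ k = + (2 ℕ.^ k)

  pow₂-suc : ∀ k → pow₂ (suc k) ≡ two * pow₂ k
  pow₂-suc k = pos-* 2 (2 ℕ.^ k)

  pow₂-+ : ∀ m n → pow₂ (m ℕ.+ n) ≡ pow₂ m * pow₂ n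
  pow₂-+ m n = trans (cong +_ (ℕ.^-distribˡ-+-* 2 m n)) (pos-* (2 ℕ.^ m) (2 ℕ.^ n))

  Evenℤ : ℤ → Set
  Evenℤ n = Σ ℤ λ h → n ≡ h + h

  lin : ℤ × ℤ × ℤ → ℤ → ℤ → ℤ → ℤ
  lin (c₁ , c₂ , c₃) r₁ r₂ r₃ = c₁ * r₁ + c₂ * r₂ + c₃ * r₃

  lin-diff : ∀ c r₁ r₂ r₃ s₁ s₂ s₃ → lin c (r₁ - s₁) (r₂ - s₂) (r₃ - s₃) ≡ lin c r₁ r₂ r₃ - lin c s₁ s₂ s₃
  lin-diff (c₁ , c₂ , c₃) = lemma c₁ c₂ c₃
    where
    lemma : ∀ c₁ c₂ c₃ r₁ r₂ r₃ s₁ s₂ s₃ → c₁ * (r₁ - s₁) + c₂ * (r₂ - s₂) + c₃ * (r₃ - s₃)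
            ≡ c₁ * r₁ + c₂ * r₂ + c₃ * r₃ - (c₁ * s₁ + c₂ * s₂ + c₃ * s₃)
    lemma = solve-∀

  lin-+ : ∀ c r₁ r₂ r₃ s₁ s₂ s₃ → lin c (r₁ + s₁) (r₂ + s₂) (r₃ + s₃) ≡ lin c r₁ r₂ r₃ + lin c s₁ s₂ s₃
  lin-+ (c₁ , c₂ , c₃) = lemma c₁ c₂ c₃
    where
    lemma : ∀ c₁ c₂ c₃ r₁ r₂ r₃ s₁ s₂ s₃ → c₁ * (r₁ + s₁) + c₂ * (r₂ + s₂) + c₃ * (r₃ + s₃)
            ≡ c₁ * r₁ + c₂ * r₂ + c₃ * r₃ + (c₁ * s₁ + c₂ * s₂ + c₃ * s₃)
    lemma = solve-∀

  -- The forms induce {r ∈ ℤ³ : r₁ + r₂ + r₃ even} / InLattice X Y Z ≅ ∏ᵢ ℤ/msᵢ.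
  record Presentation (X Y Z : ℤ) {n : ℕ} (ms : Vec ℕ n) : Set where
    field
      form : Fin n → ℤ × ℤ × ℤ
      kills : ∀ r₁ r₂ r₃ → InLattice X Y Z r₁ r₂ r₃ → ∀ i → + lookup ms i ∣ lin (form i) r₁ r₂ r₃
      faithful : ∀ r₁ r₂ r₃ → Evenℤ (r₁ + r₂ + r₃) → (∀ i → + lookup ms i ∣ lin (form i) r₁ r₂ r₃) →
                 InLattice X Y Z r₁ r₂ r₃
      onto : (t : Fin n → ℤ) → Σ ℤ λ r₁ → Σ ℤ λ r₂ → Σ ℤ λ r₃ →
             Evenℤ (r₁ + r₂ + r₃) × (∀ i → + lookup ms i ∣ lin (form i) r₁ r₂ r₃ - t i)

  module _ {X Y Z : ℤ} {n : ℕ} {ms : Vec ℕ n} (P : Presentation X Y Z ms) where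

    open Presentation P

    private
      _∣ᵢ_ : Fin n → ℤ → Set
      i ∣ᵢ v = + lookup ms i ∣ v

    presentation-swap₁₂ : Presentation Y X Z ms
    presentation-swap₁₂ = record
      { form = λ i → swap (form i)
      ; kills = λ { r₁ r₂ r₃ (p , u₁ , u₂ , u₃ , e₁ , e₂ , e₃) i →
          subst (i ∣ᵢ_) (sym (lin-swap (form i) r₁ r₂ r₃)) (kills r₂ r₁ r₃ (p , u₂ , u₁ , u₃ , e₂ , e₁ , e₃) i) }
      ; faithful = λ r₁ r₂ r₃ ev dv →
          unswap (faithful r₂ r₁ r₃ (even-swap r₁ r₂ r₃ ev) (λ i → subst (i ∣ᵢ_) (lin-swap (form i) r₁ r₂ r₃) (dv i)))
      ; onto = λ t → let (r₁ , r₂ , r₃ , ev , dv) = onto t in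
          r₂ , r₁ , r₃ , even-swap r₁ r₂ r₃ ev , λ i → subst (λ v → i ∣ᵢ (v - t i)) (sym (lin-swap (form i) r₂ r₁ r₃)) (dv i)
      }
      where
      swap : ℤ × ℤ × ℤ → ℤ × ℤ × ℤ
      swap (c₁ , c₂ , c₃) = c₂ , c₁ , c₃
      lin-swap : ∀ c r₁ r₂ r₃ → lin (swap c) r₁ r₂ r₃ ≡ lin c r₂ r₁ r₃
      lin-swap (c₁ , c₂ , c₃) r₁ r₂ r₃ = lemma c₁ c₂ c₃ r₁ r₂ r₃
        where
        lemma : ∀ c₁ c₂ c₃ r₁ r₂ r₃ → c₂ * r₁ + c₁ * r₂ + c₃ * r₃ ≡ c₁ * r₂ + c₂ * r₁ + c₃ * r₃
        lemma = solve-∀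
      even-swap : ∀ r₁ r₂ r₃ → Evenℤ (r₁ + r₂ + r₃) → Evenℤ (r₂ + r₁ + r₃)
      even-swap r₁ r₂ r₃ (h , e) = h , trans (cong (_+ r₃) (+-comm r₂ r₁)) e
      unswap : ∀ {r₁ r₂ r₃} → InLattice X Y Z r₂ r₁ r₃ → InLattice Y X Z r₁ r₂ r₃
      unswap (p , u₁ , u₂ , u₃ , e₁ , e₂ , e₃) = p , u₂ , u₁ , u₃ , e₂ , e₁ , e₃

    presentation-swap₂₃ : Presentation X Z Y ms
    presentation-swap₂₃ = record
      { form = λ i → swap (form i)
      ; kills = λ { r₁ r₂ r₃ (p , u₁ , u₂ , u₃ , e₁ , e₂ , e₃) i →
          subst (i ∣ᵢ_) (sym (lin-swap (form i) r₁ r₂ r₃)) (kills r₁ r₃ r₂ (p , u₁ , u₃ , u₂ , e₁ , e₃ , e₂) i) }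
      ; faithful = λ r₁ r₂ r₃ ev dv →
          unswap (faithful r₁ r₃ r₂ (even-swap r₁ r₂ r₃ ev) (λ i → subst (i ∣ᵢ_) (lin-swap (form i) r₁ r₂ r₃) (dv i)))
      ; onto = λ t → let (r₁ , r₂ , r₃ , ev , dv) = onto t in
          r₁ , r₃ , r₂ , even-swap r₁ r₂ r₃ ev , λ i → subst (λ v → i ∣ᵢ (v - t i)) (sym (lin-swap (form i) r₁ r₃ r₂)) (dv i)
      }
      where
      swap : ℤ × ℤ × ℤ → ℤ × ℤ × ℤ
      swap (c₁ , c₂ , c₃) = c₁ , c₃ , c₂
      lin-swap : ∀ c r₁ r₂ r₃ → lin (swap c) r₁ r₂ r₃ ≡ lin c r₁ r₃ r₂
      lin-swap (c₁ , c₂ , c₃) r₁ r₂ r₃ = lemma c₁ c₂ c₃ r₁ r₂ r₃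
        where
        lemma : ∀ c₁ c₂ c₃ r₁ r₂ r₃ → c₁ * r₁ + c₃ * r₂ + c₂ * r₃ ≡ c₁ * r₁ + c₂ * r₃ + c₃ * r₂
        lemma = solve-∀
      even-swap : ∀ r₁ r₂ r₃ → Evenℤ (r₁ + r₂ + r₃) → Evenℤ (r₁ + r₃ + r₂)
      even-swap r₁ r₂ r₃ (h , e) = h , trans (lemma r₁ r₂ r₃) e
        where
        lemma : ∀ r₁ r₂ r₃ → r₁ + r₃ + r₂ ≡ r₁ + r₂ + r₃
        lemma = solve-∀
      unswap : ∀ {r₁ r₂ r₃} → InLattice X Y Z r₁ r₃ r₂ → InLattice X Z Y r₁ r₂ r₃
      unswap (p , u₁ , u₂ , u₃ , e₁ , e₂ , e₃) = p , u₁ , u₃ , u₂ , e₁ , e₃ , e₂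

  module Cyclic (k : ℕ) where
    ms : Vec ℕ 1
    ms = 2 ℕ.^ (suc k ℕ.+ 1) ∷ []
    X x : ℤ
    X = pow₂ (suc k)
    x = pow₂ k
    m≡X*2 : + (2 ℕ.^ (suc k ℕ.+ 1)) ≡ X * two
    m≡X*2 = pow₂-+ (suc k) 1

    kills : ∀ r₁ r₂ r₃ → InLattice (pow₂ 0) X (pow₂ 0) r₁ r₂ r₃ → ∀ i → + lookup ms i ∣ lin (- X , 1ℤ , 0ℤ) r₁ r₂ r₃
    kills _ _ _ (p , u₁ , u₂ , u₃ , refl , refl , refl) zero =
      divides (u₂ - u₁) (trans (lemma X p u₁ u₂ u₃) (cong ((u₂ - u₁) *_) (sym m≡X*2)))
      where
      lemma : ∀ X p u₁ u₂ u₃ → - X * (1ℤ * (p + two * u₁)) + 1ℤ * (X * (p + two * u₂)) + 0ℤ * (1ℤ * (p + two * u₃))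
              ≡ (u₂ - u₁) * (X * two)
      lemma = solve-∀

    faithful : ∀ r₁ r₂ r₃ → Evenℤ (r₁ + r₂ + r₃) → (∀ i → + lookup ms i ∣ lin (- X , 1ℤ , 0ℤ) r₁ r₂ r₃) →
               InLattice (pow₂ 0) X (pow₂ 0) r₁ r₂ r₃
    faithful r₁ r₂ r₃ (h , ev) dv with dv zero
    ... | divides q eq = r₁ , 0ℤ , q , h - x * r₁ - two * x * q - r₁ , lemma₁ r₁ , r₂≡ , r₃≡
      where
      open ≡-Reasoning
      lemma₁ : ∀ r₁ → r₁ ≡ 1ℤ * (r₁ + two * 0ℤ)
      lemma₁ = solve-∀
      r₂≡ : r₂ ≡ X * (r₁ + two * q)
      r₂≡ = begin
        r₂                                   ≡⟨ lemma X r₁ r₂ r₃ ⟩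
        (- X * r₁ + 1ℤ * r₂ + 0ℤ * r₃) + X * r₁ ≡⟨ cong (_+ X * r₁) (trans eq (cong (q *_) m≡X*2)) ⟩
        q * (X * two) + X * r₁               ≡⟨ lemma′ X r₁ q ⟩
        X * (r₁ + two * q)                   ∎
        where
        lemma : ∀ X r₁ r₂ r₃ → r₂ ≡ (- X * r₁ + 1ℤ * r₂ + 0ℤ * r₃) + X * r₁
        lemma = solve-∀
        lemma′ : ∀ X r₁ q → q * (X * two) + X * r₁ ≡ X * (r₁ + two * q)
        lemma′ = solve-∀
      r₃≡ : r₃ ≡ 1ℤ * (r₁ + two * (h - x * r₁ - two * x * q - r₁))
      r₃≡ = begin
        r₃                                       ≡⟨ lemma r₁ r₂ r₃ ⟩
        (r₁ + r₂ + r₃) - r₂ - r₁                 ≡⟨ cong₂ (λ u v → u - v - r₁) ev (trans r₂≡ (cong (_* (r₁ + two * q)) (pow₂-suc k))) ⟩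
        (h + h) - two * x * (r₁ + two * q) - r₁  ≡⟨ lemma′ h x r₁ q ⟩
        1ℤ * (r₁ + two * (h - x * r₁ - two * x * q - r₁)) ∎
        where
        lemma : ∀ r₁ r₂ r₃ → r₃ ≡ (r₁ + r₂ + r₃) - r₂ - r₁
        lemma = solve-∀
        lemma′ : ∀ h x r₁ q → (h + h) - two * x * (r₁ + two * q) - r₁ ≡ 1ℤ * (r₁ + two * (h - x * r₁ - two * x * q - r₁))
        lemma′ = solve-∀

    onto : (t : Fin 1 → ℤ) → Σ ℤ λ r₁ → Σ ℤ λ r₂ → Σ ℤ λ r₃ →
           Evenℤ (r₁ + r₂ + r₃) × (∀ i → + lookup ms i ∣ lin (- X , 1ℤ , 0ℤ) r₁ r₂ r₃ - t i)
    onto t = 0ℤ , t zero , t zero , (t zero , cong (_+ t zero) (+-identityˡ (t zero))) ,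
      λ { zero → divides 0ℤ (trans (lemma X (t zero)) (sym (*-zeroˡ (+ lookup ms zero)))) }
      where
      lemma : ∀ X t → - X * 0ℤ + 1ℤ * t + 0ℤ * t - t ≡ 0ℤ
      lemma = solve-∀

  cyclic : ∀ k → Presentation (pow₂ 0) (pow₂ (suc k)) (pow₂ 0) (2 ℕ.^ (suc k ℕ.+ 1) ∷ [])
  cyclic k = record { form = λ _ → - X , 1ℤ , 0ℤ ; kills = kills ; faithful = faithful ; onto = onto }
    where open Cyclic k

  module Bicyclic (k l : ℕ) (ev : Evenℤ (pow₂ k + pow₂ l)) where
    open ≡-Reasoning
    X Y x y : ℤ
    X = pow₂ (suc k)
    Y = pow₂ (suc l)
    x = pow₂ k
    y = pow₂ l
    e : ℤ
    e = proj₁ ev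
    x+y≡2e : x + y ≡ e + e
    x+y≡2e = proj₂ ev
    ms : Vec ℕ 2
    ms = 2 ℕ.^ (suc k ℕ.+ 1) ∷ 2 ℕ.^ (suc l ℕ.+ 1) ∷ []
    m₁≡ : + lookup ms zero ≡ two * x * two
    m₁≡ = trans (pow₂-+ (suc k) 1) (cong (_* two) (pow₂-suc k))
    m₂≡ : + lookup ms (suc zero) ≡ two * y * two
    m₂≡ = trans (pow₂-+ (suc l) 1) (cong (_* two) (pow₂-suc l))

    form : Fin 2 → ℤ × ℤ × ℤ
    form zero = 1ℤ , 0ℤ , - x
    form (suc zero) = 0ℤ , 1ℤ , - y

    kills : ∀ r₁ r₂ r₃ → InLattice X Y (pow₂ 1) r₁ r₂ r₃ → ∀ i → + lookup ms i ∣ lin (form i) r₁ r₂ r₃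
    kills _ _ _ (p , u₁ , u₂ , u₃ , refl , refl , refl) zero = divides (u₁ - u₃) (begin
      1ℤ * (X * (p + two * u₁)) + 0ℤ * (Y * (p + two * u₂)) + - x * (two * (p + two * u₃))
        ≡⟨ cong (λ v → 1ℤ * (v * (p + two * u₁)) + 0ℤ * (Y * (p + two * u₂)) + - x * (two * (p + two * u₃))) (pow₂-suc k) ⟩
      1ℤ * (two * x * (p + two * u₁)) + 0ℤ * (Y * (p + two * u₂)) + - x * (two * (p + two * u₃))
        ≡⟨ lemma x Y p u₁ u₂ u₃ ⟩
      (u₁ - u₃) * (two * x * two) ≡⟨ cong ((u₁ - u₃) *_) m₁≡ ⟨
      (u₁ - u₃) * + lookup ms zero ∎)
      where
      lemma : ∀ x Y p u₁ u₂ u₃ → 1ℤ * (two * x * (p + two * u₁)) + 0ℤ * (Y * (p + two * u₂)) + - x * (two * (p + two * u₃))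
              ≡ (u₁ - u₃) * (two * x * two)
      lemma = solve-∀
    kills _ _ _ (p , u₁ , u₂ , u₃ , refl , refl , refl) (suc zero) = divides (u₂ - u₃) (begin
      0ℤ * (X * (p + two * u₁)) + 1ℤ * (Y * (p + two * u₂)) + - y * (two * (p + two * u₃))
        ≡⟨ cong (λ v → 0ℤ * (X * (p + two * u₁)) + 1ℤ * (v * (p + two * u₂)) + - y * (two * (p + two * u₃))) (pow₂-suc l) ⟩
      0ℤ * (X * (p + two * u₁)) + 1ℤ * (two * y * (p + two * u₂)) + - y * (two * (p + two * u₃))
        ≡⟨ lemma y X p u₁ u₂ u₃ ⟩
      (u₂ - u₃) * (two * y * two) ≡⟨ cong ((u₂ - u₃) *_) m₂≡ ⟨
      (u₂ - u₃) * + lookup ms (suc zero) ∎)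
      where
      lemma : ∀ y X p u₁ u₂ u₃ → 0ℤ * (X * (p + two * u₁)) + 1ℤ * (two * y * (p + two * u₂)) + - y * (two * (p + two * u₃))
              ≡ (u₂ - u₃) * (two * y * two)
      lemma = solve-∀

    faithful : ∀ r₁ r₂ r₃ → Evenℤ (r₁ + r₂ + r₃) → (∀ i → + lookup ms i ∣ lin (form i) r₁ r₂ r₃) →
               InLattice X Y (pow₂ 1) r₁ r₂ r₃
    faithful r₁ r₂ r₃ (h , ev) dv with dv zero | dv (suc zero)
    ... | divides q₁ eq₁ | divides q₂ eq₂ = t , q₁ , q₂ , 0ℤ , r₁≡ , r₂≡ , trans r₃≡2t (cong (two *_) (sym (+-identityʳ t)))
      where
      eq₁′ : r₁ - x * r₃ ≡ q₁ * (two * x * two)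
      eq₁′ = trans (lemma r₁ r₂ r₃ x) (trans eq₁ (cong (q₁ *_) m₁≡))
        where
        lemma : ∀ r₁ r₂ r₃ x → r₁ - x * r₃ ≡ 1ℤ * r₁ + 0ℤ * r₂ + - x * r₃
        lemma = solve-∀
      eq₂′ : r₂ - y * r₃ ≡ q₂ * (two * y * two)
      eq₂′ = trans (lemma r₁ r₂ r₃ y) (trans eq₂ (cong (q₂ *_) m₂≡))
        where
        lemma : ∀ r₁ r₂ r₃ y → r₂ - y * r₃ ≡ 0ℤ * r₁ + 1ℤ * r₂ + - y * r₃
        lemma = solve-∀
      t : ℤ
      t = h - two * (x * q₁ + y * q₂) - e * r₃
      -- r₃ is even because x + y is
      r₃≡2t : r₃ ≡ two * t
      r₃≡2t = begin
        r₃                                                         ≡⟨ lemma r₁ r₂ r₃ x y ⟩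
        (r₁ + r₂ + r₃) - (x + y) * r₃ - (r₁ - x * r₃) - (r₂ - y * r₃) ≡⟨ cong₂ _-_ (cong₂ _-_ (cong₂ _-_ ev (cong (_* r₃) x+y≡2e)) eq₁′) eq₂′ ⟩
        (h + h) - (e + e) * r₃ - q₁ * (two * x * two) - q₂ * (two * y * two) ≡⟨ lemma′ h e r₃ q₁ q₂ x y ⟩
        two * t                                                    ∎
        where
        lemma : ∀ r₁ r₂ r₃ x y → r₃ ≡ (r₁ + r₂ + r₃) - (x + y) * r₃ - (r₁ - x * r₃) - (r₂ - y * r₃)
        lemma = solve-∀
        lemma′ : ∀ h e r₃ q₁ q₂ x y → (h + h) - (e + e) * r₃ - q₁ * (two * x * two) - q₂ * (two * y * two)
                 ≡ two * (h - two * (x * q₁ + y * q₂) - e * r₃)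
        lemma′ = solve-∀
      recover : ∀ {r q} z → pow₂ (suc z) ≡ two * pow₂ z → r - pow₂ z * r₃ ≡ q * (two * pow₂ z * two) →
                r ≡ pow₂ (suc z) * (t + two * q)
      recover {r} {q} z Z≡ eq = begin
        r                                        ≡⟨ lemma r (pow₂ z) r₃ ⟩
        (r - pow₂ z * r₃) + pow₂ z * r₃           ≡⟨ cong₂ _+_ eq (cong (pow₂ z *_) r₃≡2t) ⟩
        q * (two * pow₂ z * two) + pow₂ z * (two * t) ≡⟨ lemma′ q (pow₂ z) t ⟩
        (two * pow₂ z) * (t + two * q)           ≡⟨ cong (_* (t + two * q)) Z≡ ⟨
        pow₂ (suc z) * (t + two * q)             ∎
        where
        lemma : ∀ r x r₃ → r ≡ (r - x * r₃) + x * r₃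
        lemma = solve-∀
        lemma′ : ∀ q x t → q * (two * x * two) + x * (two * t) ≡ (two * x) * (t + two * q)
        lemma′ = solve-∀
      r₁≡ : r₁ ≡ X * (t + two * q₁)
      r₁≡ = recover k (pow₂-suc k) eq₁′
      r₂≡ : r₂ ≡ Y * (t + two * q₂)
      r₂≡ = recover l (pow₂-suc l) eq₂′

    onto : (t : Fin 2 → ℤ) → Σ ℤ λ r₁ → Σ ℤ λ r₂ → Σ ℤ λ r₃ →
           Evenℤ (r₁ + r₂ + r₃) × (∀ i → + lookup ms i ∣ lin (form i) r₁ r₂ r₃ - t i)
    onto t = t₀ + s * x , t₁ + s * y , s , (s * (1ℤ + e) , sum-even) , onto-at
      where
      t₀ t₁ s : ℤ
      t₀ = t zero
      t₁ = t (suc zero)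
      s = t₀ + t₁
      sum-even : t₀ + s * x + (t₁ + s * y) + s ≡ s * (1ℤ + e) + s * (1ℤ + e)
      sum-even = begin
        t₀ + s * x + (t₁ + s * y) + s ≡⟨ lemma t₀ t₁ x y ⟩
        s + s + s * (x + y)          ≡⟨ cong (λ v → s + s + s * v) x+y≡2e ⟩
        s + s + s * (e + e)          ≡⟨ lemma′ s e ⟩
        s * (1ℤ + e) + s * (1ℤ + e)  ∎
        where
        lemma : ∀ t₀ t₁ x y → t₀ + (t₀ + t₁) * x + (t₁ + (t₀ + t₁) * y) + (t₀ + t₁) ≡ (t₀ + t₁) + (t₀ + t₁) + (t₀ + t₁) * (x + y)
        lemma = solve-∀
        lemma′ : ∀ s e → s + s + s * (e + e) ≡ s * (1ℤ + e) + s * (1ℤ + e)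
        lemma′ = solve-∀
      onto-at : ∀ i → + lookup ms i ∣ lin (form i) (t₀ + s * x) (t₁ + s * y) s - t i
      onto-at zero = divides 0ℤ (trans (lemma t₀ t₁ x y) (sym (*-zeroˡ (+ lookup ms zero))))
        where
        lemma : ∀ t₀ t₁ x y → 1ℤ * (t₀ + (t₀ + t₁) * x) + 0ℤ * (t₁ + (t₀ + t₁) * y) + - x * (t₀ + t₁) - t₀ ≡ 0ℤ
        lemma = solve-∀
      onto-at (suc zero) = divides 0ℤ (trans (lemma t₀ t₁ x y) (sym (*-zeroˡ (+ lookup ms (suc zero)))))
        where
        lemma : ∀ t₀ t₁ x y → 0ℤ * (t₀ + (t₀ + t₁) * x) + 1ℤ * (t₁ + (t₀ + t₁) * y) + - y * (t₀ + t₁) - t₁ ≡ 0ℤ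
        lemma = solve-∀

  bicyclic : ∀ k l → Evenℤ (pow₂ k + pow₂ l) →
             Presentation (pow₂ (suc k)) (pow₂ (suc l)) (pow₂ 1) (2 ℕ.^ (suc k ℕ.+ 1) ∷ 2 ℕ.^ (suc l ℕ.+ 1) ∷ [])
  bicyclic k l ev = record { form = form ; kills = kills ; faithful = faithful ; onto = onto }
    where open Bicyclic k l ev

open Presentations

module Reduction where

  open import Data.Nat as ℕ using (ℕ; zero; suc)
  import Data.Nat.Properties as ℕ
  open import Data.Integer using (ℤ; +_; _+_; _-_; _*_; -_; 0ℤ; 1ℤ)
  open import Data.Integer.Properties
  open import Data.Integer.Tactic.RingSolver using (solve-∀)
  open import Data.Integer.Divisibility.Signed using (_∣_; divides; ∣⇒∣ᵤ; ∣ᵤ⇒∣)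
  open import Data.Fin using (Fin)
  open import Data.List using (List)
  open import Data.Vec using (Vec; lookup)
  open import Data.Product using (Σ; ∃; _×_; _,_; proj₂)
  open import Relation.Binary.PropositionalEquality

  odd : ℕ → ℤ
  odd h = + suc (h ℕ.+ h)

  odd≡ : ∀ h → odd h ≡ 1ℤ + two * + h
  odd≡ h = trans (pos-+ 1 (h ℕ.+ h)) (cong (λ t → 1ℤ + t) (trans (pos-+ h h) (lemma (+ h))))
    where
    lemma : ∀ h → h + h ≡ two * h
    lemma = solve-∀

  odd∣2*⇒∣ : ∀ h n → odd h ∣ two * n → odd h ∣ n
  odd∣2*⇒∣ h n (divides q eq) = divides ((1ℤ + + h) * q - n) (begin
    n                                          ≡⟨ lemma n (+ h) ⟩
    (1ℤ + + h) * (two * n) - n * (1ℤ + two * + h) ≡⟨ cong₂ (λ u v → (1ℤ + + h) * u - n * v) eq (sym (odd≡ h)) ⟩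
    (1ℤ + + h) * (q * odd h) - n * odd h        ≡⟨ lemma′ (1ℤ + + h) q n (odd h) ⟩
    ((1ℤ + + h) * q - n) * odd h                ∎)
    where
    open ≡-Reasoning
    lemma : ∀ n h → n ≡ (1ℤ + h) * (two * n) - n * (1ℤ + two * h)
    lemma = solve-∀
    lemma′ : ∀ a q n o → a * (q * o) - n * o ≡ (a * q - n) * o
    lemma′ = solve-∀

  odd∣pow₂*⇒∣ : ∀ h k n → odd h ∣ pow₂ k * n → odd h ∣ n
  odd∣pow₂*⇒∣ h zero n d = subst (odd h ∣_) (*-identityˡ n) d
  odd∣pow₂*⇒∣ h (suc k) n d = odd∣2*⇒∣ h n (odd∣pow₂*⇒∣ h k (two * n)
    (subst (odd h ∣_) (trans (cong (_* n) (pow₂-suc k)) (lemma (pow₂ k) n)) d))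
    where
    lemma : ∀ p n → two * p * n ≡ p * (two * n)
    lemma = solve-∀

  private
    swap-odd : ∀ X o s → X * o * s ≡ X * s * o
    swap-odd = solve-∀

  descale : ∀ h {q} r X s → q ≡ r * odd h → q ≡ X * odd h * s → r ≡ X * s
  descale h r X s e f = *-cancelʳ-≡ r (X * s) (odd h) (trans (sym e) (trans f (swap-odd X (odd h) s)))

  rescale : ∀ h {q r} X s → q ≡ r * odd h → r ≡ X * s → q ≡ X * odd h * s
  rescale h X s e refl = trans e (sym (swap-odd X (odd h) s))

  -- Coordinates on the 2-part: the sums Qᵢ x divided by the odd parts of α, β, γ.
  record Reduced (h₁ h₂ h₃ : ℕ) (x : ZV) : Set where
    constructor reduced
    field
      r₁ r₂ r₃ : ℤ
      Q₁≡ : Q₁ x ≡ r₁ * odd h₁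
      Q₂≡ : Q₂ x ≡ r₂ * odd h₂
      Q₃≡ : Q₃ x ≡ r₃ * odd h₃
      total≡0 : total x ≡ 0ℤ

  module _ {h₁ h₂ h₃ : ℕ} where

    open Reduced

    reduced-unique : ∀ {x} (ρ σ : Reduced h₁ h₂ h₃ x) → (r₁ ρ ≡ r₁ σ) × (r₂ ρ ≡ r₂ σ) × (r₃ ρ ≡ r₃ σ)
    reduced-unique ρ σ =
      *-cancelʳ-≡ (r₁ ρ) (r₁ σ) (odd h₁) (trans (sym (Q₁≡ ρ)) (Q₁≡ σ)) ,
      *-cancelʳ-≡ (r₂ ρ) (r₂ σ) (odd h₂) (trans (sym (Q₂≡ ρ)) (Q₂≡ σ)) ,
      *-cancelʳ-≡ (r₃ ρ) (r₃ σ) (odd h₃) (trans (sym (Q₃≡ ρ)) (Q₃≡ σ))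

    reduced-even : ∀ {x} (ρ : Reduced h₁ h₂ h₃ x) → Evenℤ (r₁ ρ + r₂ ρ + r₃ ρ)
    reduced-even {x} (reduced r₁ r₂ r₃ e₁ e₂ e₃ _) = x₁ + x₂ + x₃ - m , (begin
      r₁ + r₂ + r₃                                                  ≡⟨ lemma r₁ r₂ r₃ (+ h₁) (+ h₂) (+ h₃) ⟩
      r₁ * (1ℤ + two * + h₁) + r₂ * (1ℤ + two * + h₂) + r₃ * (1ℤ + two * + h₃) - two * m
        ≡⟨ cong (_- two * m) (cong₂ _+_ (cong₂ _+_ (odd-at r₁ h₁ e₁) (odd-at r₂ h₂ e₂)) (odd-at r₃ h₃ e₃)) ⟨
      Q₁ x + Q₂ x + Q₃ x - two * m                                  ≡⟨ lemma′ x₁ x₂ x₃ m ⟩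
      (x₁ + x₂ + x₃ - m) + (x₁ + x₂ + x₃ - m)                       ∎)
      where
      open ≡-Reasoning
      x₁ x₂ x₃ m : ℤ
      x₁ = x v₁₀
      x₂ = x v₀₁
      x₃ = x v₁₁
      m = r₁ * + h₁ + r₂ * + h₂ + r₃ * + h₃
      odd-at : ∀ r h {q} → q ≡ r * odd h → q ≡ r * (1ℤ + two * + h)
      odd-at r h e = trans e (cong (r *_) (odd≡ h))
      lemma : ∀ r₁ r₂ r₃ h₁ h₂ h₃ → r₁ + r₂ + r₃
              ≡ r₁ * (1ℤ + two * h₁) + r₂ * (1ℤ + two * h₂) + r₃ * (1ℤ + two * h₃) - two * (r₁ * h₁ + r₂ * h₂ + r₃ * h₃)
      lemma = solve-∀
      lemma′ : ∀ x₁ x₂ x₃ m → x₁ + (x₃ + 0ℤ) + (x₂ + (x₃ + 0ℤ)) + (x₁ + (x₂ + 0ℤ)) - two * m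
               ≡ (x₁ + x₂ + x₃ - m) + (x₁ + x₂ + x₃ - m)
      lemma′ = solve-∀

    reduced-diff : ∀ {x y} (ρ : Reduced h₁ h₂ h₃ x) (σ : Reduced h₁ h₂ h₃ y) → Reduced h₁ h₂ h₃ (λ w → x w - y w)
    reduced-diff {x} {y} ρ σ = reduced (r₁ ρ - r₁ σ) (r₂ ρ - r₂ σ) (r₃ ρ - r₃ σ)
      (at coset₁ (r₁ ρ) (r₁ σ) (Q₁≡ ρ) (Q₁≡ σ)) (at coset₂ (r₂ ρ) (r₂ σ) (Q₂≡ ρ) (Q₂≡ σ)) (at coset₃ (r₃ ρ) (r₃ σ) (Q₃≡ ρ) (Q₃≡ σ))
      (trans (sumOver-diff allV x y) (cong₂ _-_ (total≡0 ρ) (total≡0 σ)))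
      where
      at : ∀ vs r s {o} → sumOver vs x ≡ r * o → sumOver vs y ≡ s * o → sumOver vs (λ w → x w - y w) ≡ (r - s) * o
      at vs r s {o} e f = trans (sumOver-diff vs x y) (trans (cong₂ _-_ e f) (lemma r s o))
        where
        lemma : ∀ r s o → r * o - s * o ≡ (r - s) * o
        lemma = solve-∀

    reduced-+ : ∀ {x y} (ρ : Reduced h₁ h₂ h₃ x) (σ : Reduced h₁ h₂ h₃ y) → Reduced h₁ h₂ h₃ (x +V y)
    reduced-+ {x} {y} ρ σ = reduced (r₁ ρ + r₁ σ) (r₂ ρ + r₂ σ) (r₃ ρ + r₃ σ)
      (at coset₁ (r₁ ρ) (r₁ σ) (Q₁≡ ρ) (Q₁≡ σ)) (at coset₂ (r₂ ρ) (r₂ σ) (Q₂≡ ρ) (Q₂≡ σ)) (at coset₃ (r₃ ρ) (r₃ σ) (Q₃≡ ρ) (Q₃≡ σ))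
      (trans (sumOver-+ allV x y) (cong₂ _+_ (total≡0 ρ) (total≡0 σ)))
      where
      at : ∀ vs r s {o} → sumOver vs x ≡ r * o → sumOver vs y ≡ s * o → sumOver vs (x +V y) ≡ (r + s) * o
      at vs r s {o} e f = trans (sumOver-+ vs x y) (trans (cong₂ _+_ e f) (sym (*-distribʳ-+ o r s)))

    reduced-· : ∀ n {x} (ρ : Reduced h₁ h₂ h₃ x) → Reduced h₁ h₂ h₃ (n ·V x)
    reduced-· n {x} ρ = reduced (+ n * r₁ ρ) (+ n * r₂ ρ) (+ n * r₃ ρ)
      (at coset₁ (r₁ ρ) (Q₁≡ ρ)) (at coset₂ (r₂ ρ) (Q₂≡ ρ)) (at coset₃ (r₃ ρ) (Q₃≡ ρ))
      (trans (sumOver-· allV n x) (trans (cong (+ n *_) (total≡0 ρ)) (*-zeroʳ (+ n))))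
      where
      at : ∀ vs r {o} → sumOver vs x ≡ r * o → sumOver vs (n ·V x) ≡ + n * r * o
      at vs r {o} e = trans (sumOver-· vs n x) (trans (cong (+ n *_) e) (sym (*-assoc (+ n) r o)))

    weighted-even : ∀ r₁ r₂ r₃ → Evenℤ (r₁ + r₂ + r₃) → Evenℤ (r₁ * odd h₁ + r₂ * odd h₂ + r₃ * odd h₃)
    weighted-even r₁ r₂ r₃ (h , e) = h + m , (begin
      r₁ * odd h₁ + r₂ * odd h₂ + r₃ * odd h₃
        ≡⟨ cong₂ _+_ (cong₂ _+_ (cong (r₁ *_) (odd≡ h₁)) (cong (r₂ *_) (odd≡ h₂))) (cong (r₃ *_) (odd≡ h₃)) ⟩
      r₁ * (1ℤ + two * + h₁) + r₂ * (1ℤ + two * + h₂) + r₃ * (1ℤ + two * + h₃) ≡⟨ lemma r₁ r₂ r₃ (+ h₁) (+ h₂) (+ h₃) ⟩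
      (r₁ + r₂ + r₃) + two * m                       ≡⟨ cong (_+ two * m) e ⟩
      (h + h) + two * m                              ≡⟨ lemma′ h m ⟩
      (h + m) + (h + m)                              ∎)
      where
      open ≡-Reasoning
      m : ℤ
      m = r₁ * + h₁ + r₂ * + h₂ + r₃ * + h₃
      lemma : ∀ r₁ r₂ r₃ h₁ h₂ h₃ → r₁ * (1ℤ + two * h₁) + r₂ * (1ℤ + two * h₂) + r₃ * (1ℤ + two * h₃)
              ≡ (r₁ + r₂ + r₃) + two * (r₁ * h₁ + r₂ * h₂ + r₃ * h₃)
      lemma = solve-∀
      lemma′ : ∀ h m → (h + h) + two * m ≡ (h + m) + (h + m)
      lemma′ = solve-∀

  module _ (a b c A B C h₁ h₂ h₃ : ℕ)
           (α≡ : α a b c ≡ pow₂ A * odd h₁) (β≡ : β a b c ≡ pow₂ B * odd h₂) (γ≡ : γ a b c ≡ pow₂ C * odd h₃) where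

    open Reduced

    ReducedLattice : ∀ {x} → Reduced h₁ h₂ h₃ x → Set
    ReducedLattice ρ = InLattice (pow₂ A) (pow₂ B) (pow₂ C) (r₁ ρ) (r₂ ρ) (r₃ ρ)

    InImL⇒reduced : ∀ {d} (ρ : Reduced h₁ h₂ h₃ d) → InImL (Mabc a b c) d → ReducedLattice ρ
    InImL⇒reduced {d} ρ im = descale₃ (proj₂ (InImL⇒lattice a b c d im))
      where
      descale₃ : InLattice (α a b c) (β a b c) (γ a b c) (Q₁ d) (Q₂ d) (Q₃ d) → ReducedLattice ρ
      descale₃ (p , u₁ , u₂ , u₃ , f₁ , f₂ , f₃) = p , u₁ , u₂ , u₃ ,
        descale h₁ (r₁ ρ) (pow₂ A) (p + two * u₁) (Q₁≡ ρ) (trans f₁ (cong (_* (p + two * u₁)) α≡)) ,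
        descale h₂ (r₂ ρ) (pow₂ B) (p + two * u₂) (Q₂≡ ρ) (trans f₂ (cong (_* (p + two * u₂)) β≡)) ,
        descale h₃ (r₃ ρ) (pow₂ C) (p + two * u₃) (Q₃≡ ρ) (trans f₃ (cong (_* (p + two * u₃)) γ≡))

    reduced⇒InImL : ∀ {d} (ρ : Reduced h₁ h₂ h₃ d) → ReducedLattice ρ → InImL (Mabc a b c) d
    reduced⇒InImL {d} ρ (p , u₁ , u₂ , u₃ , g₁ , g₂ , g₃) = lattice⇒InImL a b c d (total≡0 ρ) (p , u₁ , u₂ , u₃ ,
      trans (rescale h₁ (pow₂ A) (p + two * u₁) (Q₁≡ ρ) g₁) (cong (_* (p + two * u₁)) (sym α≡)) ,
      trans (rescale h₂ (pow₂ B) (p + two * u₂) (Q₂≡ ρ) g₂) (cong (_* (p + two * u₂)) (sym β≡)) ,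
      trans (rescale h₃ (pow₂ C) (p + two * u₃) (Q₃≡ ρ) g₃) (cong (_* (p + two * u₃)) (sym γ≡)))

    reduce : ∀ x → InSyl2 (Mabc a b c) x → Reduced h₁ h₂ h₃ x
    reduce x (k , im) = from (InImL⇒lattice a b c ((2 ℕ.^ k) ·V x) im)
      where
      odd∣ : ∀ vs h X s → sumOver vs ((2 ℕ.^ k) ·V x) ≡ X * odd h * s → odd h ∣ sumOver vs x
      odd∣ vs h X s e = odd∣pow₂*⇒∣ h k _ (divides (X * s) (trans (sym (sumOver-· vs (2 ℕ.^ k) x)) (trans e (swap-odd X (odd h) s))))
      from : total ((2 ℕ.^ k) ·V x) ≡ 0ℤ × InLattice (α a b c) (β a b c) (γ a b c) (Q₁ ((2 ℕ.^ k) ·V x)) (Q₂ ((2 ℕ.^ k) ·V x)) (Q₃ ((2 ℕ.^ k) ·V x)) →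
             Reduced h₁ h₂ h₃ x
      from (t , p , u₁ , u₂ , u₃ , f₁ , f₂ , f₃) =
        reduced (quotient d₁) (quotient d₂) (quotient d₃) (equality d₁) (equality d₂) (equality d₃) total-x≡0
        where
        open _∣_
        d₁ : odd h₁ ∣ Q₁ x
        d₁ = odd∣ coset₁ h₁ (pow₂ A) (p + two * u₁) (trans f₁ (cong (_* (p + two * u₁)) α≡))
        d₂ : odd h₂ ∣ Q₂ x
        d₂ = odd∣ coset₂ h₂ (pow₂ B) (p + two * u₂) (trans f₂ (cong (_* (p + two * u₂)) β≡))
        d₃ : odd h₃ ∣ Q₃ x
        d₃ = odd∣ coset₃ h₃ (pow₂ C) (p + two * u₃) (trans f₃ (cong (_* (p + two * u₃)) γ≡))
        total-x≡0 : total x ≡ 0ℤ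
        total-x≡0 = *-cancelˡ-≡ (pow₂ k) (total x) 0ℤ {{ℕ.m^n≢0 2 k}}
          (trans (sym (sumOver-· allV (2 ℕ.^ k) x)) (trans t (sym (*-zeroʳ (pow₂ k)))))

    reduced-onto : ∀ r₁ r₂ r₃ → Evenℤ (r₁ + r₂ + r₃) → Σ ZV λ x → Σ (Reduced h₁ h₂ h₃ x) λ ρ →
                   InSyl2 (Mabc a b c) x × (Reduced.r₁ ρ ≡ r₁) × (Reduced.r₂ ρ ≡ r₂) × (Reduced.r₃ ρ ≡ r₃)
    reduced-onto r₁ r₂ r₃ ev =
      let (H , q-even) = weighted-even {h₁} {h₂} {h₃} r₁ r₂ r₃ ev
          (x , t₀ , e₁ , e₂ , e₃) = realise (r₁ * odd h₁) (r₂ * odd h₂) (r₃ * odd h₃) H q-even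
          ρ = reduced r₁ r₂ r₃ e₁ e₂ e₃ t₀
      in x , ρ , (k , reduced⇒InImL (reduced-· (2 ℕ.^ k) ρ) (in-lattice ρ)) , refl , refl , refl
      where
      k = A ℕ.+ (B ℕ.+ (C ℕ.+ 1))
      2^k≡ : pow₂ k ≡ pow₂ A * (pow₂ B * (pow₂ C * two))
      2^k≡ = trans (pow₂-+ A _) (cong (pow₂ A *_) (trans (pow₂-+ B _) (cong (pow₂ B *_) (pow₂-+ C 1))))
      at₁ : ∀ a b c r → a * (b * (c * two)) * r ≡ a * (0ℤ + two * (b * c * r))
      at₁ = solve-∀
      at₂ : ∀ a b c r → a * (b * (c * two)) * r ≡ b * (0ℤ + two * (a * c * r))
      at₂ = solve-∀
      at₃ : ∀ a b c r → a * (b * (c * two)) * r ≡ c * (0ℤ + two * (a * b * r))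
      at₃ = solve-∀
      in-lattice : ∀ {x} (ρ : Reduced h₁ h₂ h₃ x) → ReducedLattice (reduced-· (2 ℕ.^ k) ρ)
      in-lattice ρ = 0ℤ , pow₂ B * pow₂ C * Reduced.r₁ ρ , pow₂ A * pow₂ C * Reduced.r₂ ρ , pow₂ A * pow₂ B * Reduced.r₃ ρ ,
        trans (cong (_* Reduced.r₁ ρ) 2^k≡) (at₁ (pow₂ A) (pow₂ B) (pow₂ C) (Reduced.r₁ ρ)) ,
        trans (cong (_* Reduced.r₂ ρ) 2^k≡) (at₂ (pow₂ A) (pow₂ B) (pow₂ C) (Reduced.r₂ ρ)) ,
        trans (cong (_* Reduced.r₃ ρ) 2^k≡) (at₃ (pow₂ A) (pow₂ B) (pow₂ C) (Reduced.r₃ ρ))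

    module Syl2Coordinates {n} {ms : Vec ℕ n} (P : Presentation (pow₂ A) (pow₂ B) (pow₂ C) ms) where
      open Presentation P
      open ≡-Reasoning
      M : List V
      M = Mabc a b c

      _∣ᵢ_ : Fin n → ℤ → Set
      i ∣ᵢ v = + lookup ms i ∣ v

      coords : ∀ {x} → Reduced h₁ h₂ h₃ x → Fin n → ℤ
      coords ρ i = lin (form i) (r₁ ρ) (r₂ ρ) (r₃ ρ)

      φ : (x : ZV) → InSyl2 M x → Fin n → ℤ
      φ x px = coords (reduce x px)

      coords-diff : ∀ {x y} (ρ : Reduced h₁ h₂ h₃ x) (σ : Reduced h₁ h₂ h₃ y) i → coords (reduced-diff ρ σ) i ≡ coords ρ i - coords σ i
      coords-diff ρ σ i = lin-diff (form i) (r₁ ρ) (r₂ ρ) (r₃ ρ) (r₁ σ) (r₂ σ) (r₃ σ)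

      coords-+ : ∀ {x y} (ρ : Reduced h₁ h₂ h₃ x) (σ : Reduced h₁ h₂ h₃ y) i → coords (reduced-+ ρ σ) i ≡ coords ρ i + coords σ i
      coords-+ ρ σ i = lin-+ (form i) (r₁ ρ) (r₂ ρ) (r₃ ρ) (r₁ σ) (r₂ σ) (r₃ σ)

      coords-unique : ∀ {x} (ρ σ : Reduced h₁ h₂ h₃ x) i → coords ρ i ≡ coords σ i
      coords-unique ρ σ i = let (e₁ , e₂ , e₃) = reduced-unique ρ σ in
        trans (cong₂ (λ u v → lin (form i) u v (r₃ ρ)) e₁ e₂) (cong (lin (form i) (r₁ σ) (r₂ σ)) e₃)

      wd : ∀ x y px py → x ≈[ M ] y → φ x px ≡mod[ ms ] φ y py
      wd x y px py x≈y i = ∣⇒∣ᵤ (subst (i ∣ᵢ_) (coords-diff ρ σ i) (kills _ _ _ (InImL⇒reduced (reduced-diff ρ σ) x≈y) i))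
        where
        ρ : Reduced h₁ h₂ h₃ x
        ρ = reduce x px
        σ : Reduced h₁ h₂ h₃ y
        σ = reduce y py

      hom : ∀ x y px py pxy → φ (x +V y) pxy ≡mod[ ms ] (λ i → φ x px i + φ y py i)
      hom x y px py pxy i = ∣⇒∣ᵤ {+ lookup ms i} (divides 0ℤ (begin
        coords (reduce (x +V y) pxy) i - (coords ρ i + coords σ i)
          ≡⟨ cong (_- (coords ρ i + coords σ i)) (trans (coords-unique (reduce (x +V y) pxy) (reduced-+ ρ σ) i) (coords-+ ρ σ i)) ⟩
        (coords ρ i + coords σ i) - (coords ρ i + coords σ i) ≡⟨ +-inverseʳ (coords ρ i + coords σ i) ⟩
        0ℤ                                                   ≡⟨ *-zeroˡ (+ lookup ms i) ⟨
        0ℤ * + lookup ms i                                   ∎))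
        where
        ρ : Reduced h₁ h₂ h₃ x
        ρ = reduce x px
        σ : Reduced h₁ h₂ h₃ y
        σ = reduce y py

      inj : ∀ x y px py → φ x px ≡mod[ ms ] φ y py → x ≈[ M ] y
      inj x y px py φx≡φy = reduced⇒InImL (reduced-diff ρ σ)
        (faithful _ _ _ (reduced-even (reduced-diff ρ σ)) λ i → subst (i ∣ᵢ_) (sym (coords-diff ρ σ i)) (∣ᵤ⇒∣ (φx≡φy i)))
        where
        ρ : Reduced h₁ h₂ h₃ x
        ρ = reduce x px
        σ : Reduced h₁ h₂ h₃ y
        σ = reduce y py

      surj : (t : Fin n → ℤ) → ∃ λ x → Σ (InSyl2 M x) λ px → φ x px ≡mod[ ms ] t
      surj t = let (r₁ , r₂ , r₃ , ev , dv) = onto t ; (x , ρ , px , e₁ , e₂ , e₃) = reduced-onto r₁ r₂ r₃ ev in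
        x , px , λ i → ∣⇒∣ᵤ (subst (λ v → i ∣ᵢ (v - t i))
          (trans (cong₂ (λ u v → lin (form i) u v r₃) e₁ e₂) (trans (cong (lin (form i) (Reduced.r₁ ρ) (Reduced.r₂ ρ)) e₃)
            (coords-unique ρ (reduce x px) i))) (dv i))

    syl2Iso : ∀ {n} {ms : Vec ℕ n} → Presentation (pow₂ A) (pow₂ B) (pow₂ C) ms → Syl2Iso (Mabc a b c) ms
    syl2Iso P = record { φ = φ ; wd = wd ; hom = hom ; inj = inj ; surj = surj }
      where open Syl2Coordinates P

  presentation⇒Syl2Iso : ∀ a b c {A B C n} {ms : Vec ℕ n} →
                         a ℕ.+ c ≡2^ A *odd → b ℕ.+ c ≡2^ B *odd → a ℕ.+ b ≡2^ C *odd →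
                         Presentation (pow₂ A) (pow₂ B) (pow₂ C) ms → Syl2Iso (Mabc a b c) ms
  presentation⇒Syl2Iso a b c {A} {B} {C} (h₁ , e₁) (h₂ , e₂) (h₃ , e₃) =
    syl2Iso a b c A B C h₁ h₂ h₃ (toℤ a c A h₁ e₁) (toℤ b c B h₂ e₂) (toℤ a b C h₃ e₃)
    where
    toℤ : ∀ m n k h → m ℕ.+ n ≡ 2 ℕ.^ k ℕ.* suc (h ℕ.+ h) → + (m ℕ.+ n) ≡ pow₂ k * odd h
    toℤ m n k h e = trans (cong +_ e) (pos-* (2 ℕ.^ k) (suc (h ℕ.+ h)))

open Reduction

module Cardinality where

  open import Data.Nat as ℕ using (ℕ; zero; suc; NonZero; _<_)
  import Data.Nat.Properties as ℕ
  open import Data.Nat.DivMod using (m≡m%n+[m/n]*n)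
  open import Data.Integer using (ℤ; +_; _+_; _-_; _*_; -_; 0ℤ; +[1+_]; -[1+_])
  open import Data.Integer.Properties
  open import Data.Integer.DivMod using (_/ℕ_; _%ℕ_; n%ℕd<d; a≡a%ℕn+[a/ℕn]*n)
  open import Data.Integer.Tactic.RingSolver using (solve-∀; solve)
  open import Data.Nat.Tactic.RingSolver using () renaming (solve-∀ to ℕ-solve-∀)
  open import Data.List using (List; []; _∷_)
  open import Data.Fin using (Fin; toℕ; fromℕ<; combine; remQuot)
  open import Data.Fin.Properties using (toℕ<n; toℕ-fromℕ<; toℕ-injective; remQuot-combine; combine-remQuot)
  open import Data.Product using (Σ; ∃; _×_; _,_; proj₁; proj₂)
  open import Data.Empty using (⊥-elim)
  open import Relation.Binary.PropositionalEquality

  module _ {m n k : ℕ} where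

    split₃ : Fin (m ℕ.* (n ℕ.* k)) → Fin m × Fin n × Fin k
    split₃ i = let (I , JK) = remQuot {m} (n ℕ.* k) i in I , remQuot {n} k JK

    join₃ : Fin m × Fin n × Fin k → Fin (m ℕ.* (n ℕ.* k))
    join₃ (I , J , K) = combine I (combine J K)

    split₃-join₃ : ∀ t → split₃ (join₃ t) ≡ t
    split₃-join₃ (I , J , K) = trans (cong (λ p → proj₁ p , remQuot {n} k (proj₂ p)) (remQuot-combine I (combine J K)))
                                     (cong (I ,_) (remQuot-combine J K))

    join₃-split₃ : ∀ i → join₃ (split₃ i) ≡ i
    join₃-split₃ i = let (I , JK) = remQuot {m} (n ℕ.* k) i in
      trans (cong (combine I) (combine-remQuot {n} k JK)) (combine-remQuot {m} (n ℕ.* k) i)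

    split₃-injective : ∀ {i j} → split₃ i ≡ split₃ j → i ≡ j
    split₃-injective {i} {j} e = trans (sym (join₃-split₃ i)) (trans (cong join₃ e) (join₃-split₃ j))

  divMod : ∀ v d .{{_ : NonZero d}} → Σ ℕ λ r → Σ ℤ λ s → (r < d) × (v ≡ + r + s * + d)
  divMod v d = v %ℕ d , v /ℕ d , n%ℕd<d v d , a≡a%ℕn+[a/ℕn]*n v d

  private
    no-positive-multiple : ∀ A I I′ n → I < A → + I - + I′ ≢ + A * +[1+ n ]
    no-positive-multiple A I I′ n I<A e = ℕ.<-irrefl refl (ℕ.<-≤-trans I<A (begin
      A                     ≤⟨ ℕ.m≤m*n A (suc n) ⟩
      A ℕ.* suc n           ≤⟨ ℕ.m≤m+n (A ℕ.* suc n) I′ ⟩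
      A ℕ.* suc n ℕ.+ I′    ≡⟨ I≡ ⟨
      I                     ∎))
      where
      open ℕ.≤-Reasoning
      I≡ : I ≡ A ℕ.* suc n ℕ.+ I′
      I≡ = +-injective (trans (lemma (+ I) (+ I′)) (trans (cong (_+ + I′) (trans e (sym (pos-* A (suc n))))) (sym (pos-+ (A ℕ.* suc n) I′))))
        where
        lemma : ∀ i i′ → i ≡ (i - i′) + i′
        lemma = solve-∀

  bounded-multiple : ∀ A I I′ t → I < A → I′ < A → + I - + I′ ≡ + A * t → t ≡ 0ℤ
  bounded-multiple A I I′ (+ zero) _ _ _ = refl
  bounded-multiple A I I′ +[1+ n ] I<A _ e = ⊥-elim (no-positive-multiple A I I′ n I<A e)
  bounded-multiple A I I′ -[1+ n ] _ I′<A e = ⊥-elim (no-positive-multiple A I′ I n I′<A (trans (lemma (+ I) (+ I′)) (trans (cong -_ e) (lemma′ (+ A) -[1+ n ]))))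
    where
    lemma : ∀ i i′ → i′ - i ≡ - (i - i′)
    lemma = solve-∀
    lemma′ : ∀ a t → - (a * t) ≡ a * (- t)
    lemma′ = solve-∀

  bounded-multiple⇒≡ : ∀ A {I I′ t} → + I - + I′ ≡ + A * t → t ≡ 0ℤ → I ≡ I′
  bounded-multiple⇒≡ A e refl = +-injective (i-j≡0⇒i≡j _ _ (trans e (*-zeroʳ (+ A))))

  private
    third-coordinate : ∀ (A B C S q₁ q₂ q₃ e i j k ε h t₁ s₂ s₃ : ℤ) →
      q₃ ≡ e + e - q₁ - q₂ → q₁ ≡ i + t₁ * A → q₂ ≡ B * t₁ + (j + s₂ * (two * B)) → i ≡ ε + two * h - j →
      k ≡ e - h - ε - S * t₁ - B * s₂ - s₃ * C → C ≡ S + S - A - B →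
      k + k + ε - q₃ ≡ C * (- t₁ + two * (- s₃))
    third-coordinate A B _ S _ _ _ e _ j _ ε h t₁ s₂ s₃ refl refl refl refl refl refl =
      solve (A ∷ B ∷ S ∷ e ∷ j ∷ ε ∷ h ∷ t₁ ∷ s₂ ∷ s₃ ∷ [])

  -- Representatives (I, J, 2K + (I + J) mod 2) with I < α, J < 2β, K < γ of
  -- {q ∈ ℤ³ : q₁ + q₂ + q₃ even} modulo InLattice α β γ, for α + β + γ even.
  module Transversal (α β γ σ : ℕ) .{{_ : NonZero α}} .{{_ : NonZero β}} .{{_ : NonZero γ}}
                     (α+β+γ≡σ+σ : α ℕ.+ β ℕ.+ γ ≡ σ ℕ.+ σ) where

    ε half : ℕ → ℕ → ℤ
    ε I J = + ((I ℕ.+ J) ℕ.% 2)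
    half I J = + ((I ℕ.+ J) ℕ./ 2)

    I+J≡ : ∀ I J → + I + + J ≡ ε I J + two * half I J
    I+J≡ I J = trans (sym (pos-+ I J)) (trans (cong +_ (m≡m%n+[m/n]*n (I ℕ.+ J) 2))
      (trans (pos-+ ((I ℕ.+ J) ℕ.% 2) _) (cong (λ v → ε I J + v) (trans (pos-* ((I ℕ.+ J) ℕ./ 2) 2) (*-comm (half I J) two)))))

    third : ℕ → ℕ → ℕ → ℤ
    third I J K = + K + + K + ε I J

    Λ : ℤ → ℤ → ℤ → Set
    Λ = InLattice (+ α) (+ β) (+ γ)

    representative : ∀ q₁ q₂ q₃ → Evenℤ (q₁ + q₂ + q₃) → Σ ℕ λ I → Σ ℕ λ J → Σ ℕ λ K →
                     (I < α) × (J < 2 ℕ.* β) × (K < γ) × Λ (+ I - q₁) (+ J - q₂) (third I J K - q₃)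
    representative q₁ q₂ q₃ (e , q≡) with divMod q₁ α
    ... | I , t₁ , I<α , q₁≡ with divMod (q₂ - + β * t₁) (2 ℕ.* β) {{ℕ.m*n≢0 2 β}}
    ... | J , s₂ , J<2β , q₂≡ with divMod (e - half I J - ε I J - + σ * t₁ - + β * s₂) γ
    ... | K , s₃ , K<γ , w≡ = I , J , K , I<α , J<2β , K<γ , - t₁ , 0ℤ , - s₂ , - s₃ ,
      trans (cong (λ v → + I - v) q₁≡′) (first (+ I) t₁ (+ α)) ,
      trans (cong (λ v → + J - v) q₂≡′) (second (+ J) t₁ s₂ (+ β)) ,
      third-coordinate (+ α) (+ β) (+ γ) (+ σ) q₁ q₂ q₃ e (+ I) (+ J) (+ K) (ε I J) (half I J) t₁ s₂ s₃
        q₃≡ q₁≡′ q₂≡′ I≡ K≡ γ≡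
      where
      q₁≡′ : q₁ ≡ + I + t₁ * + α
      q₁≡′ = q₁≡
      first : ∀ i t a → i - (i + t * a) ≡ a * (- t + two * 0ℤ)
      first = solve-∀
      q₂≡′ : q₂ ≡ + β * t₁ + (+ J + s₂ * (two * + β))
      q₂≡′ = trans (lemma q₂ (+ β * t₁)) (cong (λ v → + β * t₁ + v) (trans q₂≡ (cong (λ m → + J + s₂ * m) (pos-* 2 β))))
        where
        lemma : ∀ q m → q ≡ m + (q - m)
        lemma = solve-∀
      second : ∀ j t s b → j - (b * t + (j + s * (two * b))) ≡ b * (- t + two * (- s))
      second = solve-∀
      q₃≡ : q₃ ≡ e + e - q₁ - q₂
      q₃≡ = trans (lemma q₁ q₂ q₃) (cong (λ v → v - q₁ - q₂) q≡)
        where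
        lemma : ∀ q₁ q₂ q₃ → q₃ ≡ q₁ + q₂ + q₃ - q₁ - q₂
        lemma = solve-∀
      I≡ : + I ≡ ε I J + two * half I J - + J
      I≡ = trans (lemma (+ I) (+ J)) (cong (_- + J) (I+J≡ I J))
        where
        lemma : ∀ i j → i ≡ i + j - j
        lemma = solve-∀
      K≡ : + K ≡ e - half I J - ε I J - + σ * t₁ - + β * s₂ - s₃ * + γ
      K≡ = trans (lemma (+ K) (s₃ * + γ)) (cong (_- s₃ * + γ) (sym w≡))
        where
        lemma : ∀ k m → k ≡ k + m - m
        lemma = solve-∀
      γ≡ : + γ ≡ + σ + + σ - + α - + β
      γ≡ = trans (lemma (+ α) (+ β) (+ γ)) (cong (λ v → v - + α - + β)
        (trans (sym (trans (pos-+ (α ℕ.+ β) γ) (cong (_+ + γ) (pos-+ α β)))) (trans (cong +_ α+β+γ≡σ+σ) (pos-+ σ σ))))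
        where
        lemma : ∀ a b c → c ≡ a + b + c - a - b
        lemma = solve-∀

    private
      K-step : ∀ I J K K′ p u₁ u₃ → p + two * u₁ ≡ 0ℤ → third I J K - third I J K′ ≡ + γ * (p + two * u₃) →
               + K - + K′ ≡ + γ * (u₃ - u₁)
      K-step I J K K′ p u₁ u₃ p+2u₁≡0 e = *-cancelˡ-≡ two _ _ (begin
        two * (+ K - + K′)                       ≡⟨ lemma (+ K) (+ K′) (ε I J) ⟩
        third I J K - third I J K′               ≡⟨ e ⟩
        + γ * (p + two * u₃)                     ≡⟨ lemma′ (+ γ) p u₁ u₃ ⟩
        + γ * (p + two * u₁) + two * (+ γ * (u₃ - u₁)) ≡⟨ cong (λ v → + γ * v + two * (+ γ * (u₃ - u₁))) p+2u₁≡0 ⟩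
        + γ * 0ℤ + two * (+ γ * (u₃ - u₁))       ≡⟨ cong (_+ two * (+ γ * (u₃ - u₁))) (*-zeroʳ (+ γ)) ⟩
        0ℤ + two * (+ γ * (u₃ - u₁))             ≡⟨ +-identityˡ _ ⟩
        two * (+ γ * (u₃ - u₁))                  ∎)
        where
        open ≡-Reasoning
        lemma : ∀ k k′ e → two * (k - k′) ≡ k + k + e - (k′ + k′ + e)
        lemma = solve-∀
        lemma′ : ∀ c p u₁ u₃ → c * (p + two * u₃) ≡ c * (p + two * u₁) + two * (c * (u₃ - u₁))
        lemma′ = solve-∀

      J-step : ∀ J J′ p u₁ u₂ → p + two * u₁ ≡ 0ℤ → + J - + J′ ≡ + β * (p + two * u₂) →
               + J - + J′ ≡ + (2 ℕ.* β) * (u₂ - u₁)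
      J-step J J′ p u₁ u₂ p+2u₁≡0 e = begin
        + J - + J′                                ≡⟨ e ⟩
        + β * (p + two * u₂)                      ≡⟨ lemma (+ β) p u₁ u₂ ⟩
        + β * (p + two * u₁) + two * + β * (u₂ - u₁) ≡⟨ cong (λ v → + β * v + two * + β * (u₂ - u₁)) p+2u₁≡0 ⟩
        + β * 0ℤ + two * + β * (u₂ - u₁)          ≡⟨ cong (_+ two * + β * (u₂ - u₁)) (*-zeroʳ (+ β)) ⟩
        0ℤ + two * + β * (u₂ - u₁)                ≡⟨ +-identityˡ _ ⟩
        two * + β * (u₂ - u₁)                     ≡⟨ cong (_* (u₂ - u₁)) (pos-* 2 β) ⟨
        + (2 ℕ.* β) * (u₂ - u₁)                   ∎
        where
        open ≡-Reasoning
        lemma : ∀ b p u₁ u₂ → b * (p + two * u₂) ≡ b * (p + two * u₁) + two * b * (u₂ - u₁)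
        lemma = solve-∀

    representative-unique : ∀ {I J K I′ J′ K′} → I < α → I′ < α → J < 2 ℕ.* β → J′ < 2 ℕ.* β → K < γ → K′ < γ →
                            Λ (+ I - + I′) (+ J - + J′) (third I J K - third I′ J′ K′) → (I ≡ I′) × (J ≡ J′) × (K ≡ K′)
    representative-unique {I} {J} {K} {I′} {J′} {K′} I<α I′<α J<2β J′<2β K<γ K′<γ (p , u₁ , u₂ , u₃ , e₁ , e₂ , e₃) =
      I≡I′ , J≡J′ , bounded-multiple⇒≡ γ eK (bounded-multiple γ K K′ _ K<γ K′<γ eK)
      where
      p+2u₁≡0 : p + two * u₁ ≡ 0ℤ
      p+2u₁≡0 = bounded-multiple α I I′ _ I<α I′<α e₁
      I≡I′ : I ≡ I′
      I≡I′ = bounded-multiple⇒≡ α e₁ p+2u₁≡0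
      eJ : + J - + J′ ≡ + (2 ℕ.* β) * (u₂ - u₁)
      eJ = J-step J J′ p u₁ u₂ p+2u₁≡0 e₂
      J≡J′ : J ≡ J′
      J≡J′ = bounded-multiple⇒≡ (2 ℕ.* β) eJ (bounded-multiple (2 ℕ.* β) J J′ _ J<2β J′<2β eJ)
      eK : + K - + K′ ≡ + γ * (u₃ - u₁)
      eK = K-step I J K K′ p u₁ u₃ p+2u₁≡0 (subst₂ (λ I″ J″ → third I J K - third I″ J″ K′ ≡ + γ * (p + two * u₃)) (sym I≡I′) (sym J≡J′) e₃)

  Q-sum-even : ∀ x → Evenℤ (Q₁ x + Q₂ x + Q₃ x)
  Q-sum-even x = x v₁₀ + x v₀₁ + x v₁₁ , lemma (x v₁₀) (x v₀₁) (x v₁₁)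
    where
    lemma : ∀ x₁ x₂ x₃ → x₁ + (x₃ + 0ℤ) + (x₂ + (x₃ + 0ℤ)) + (x₁ + (x₂ + 0ℤ)) ≡ (x₁ + x₂ + x₃) + (x₁ + x₂ + x₃)
    lemma = solve-∀

  module _ (a b c : ℕ) .{{_ : NonZero (a ℕ.+ c)}} .{{_ : NonZero (b ℕ.+ c)}} .{{_ : NonZero (a ℕ.+ b)}} where

    private
      M : List V
      M = Mabc a b c
      αₙ βₙ γₙ : ℕ
      αₙ = a ℕ.+ c
      βₙ = b ℕ.+ c
      γₙ = a ℕ.+ b

      sum≡ : ∀ a b c → a ℕ.+ c ℕ.+ (b ℕ.+ c) ℕ.+ (a ℕ.+ b) ≡ a ℕ.+ b ℕ.+ c ℕ.+ (a ℕ.+ b ℕ.+ c)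
      sum≡ = ℕ-solve-∀

    open Transversal αₙ βₙ γₙ (a ℕ.+ b ℕ.+ c) (sum≡ a b c)

    repr-even : ∀ I J K → + I + + J + third I J K ≡ (half I J + ε I J + + K) + (half I J + ε I J + + K)
    repr-even I J K = trans (cong (_+ third I J K) (I+J≡ I J)) (lemma (ε I J) (half I J) (+ K))
      where
      lemma : ∀ e h k → e + two * h + (k + k + e) ≡ (h + e + k) + (h + e + k)
      lemma = solve-∀

    repr : ℕ → ℕ → ℕ → ZV
    repr I J K = proj₁ (realise (+ I) (+ J) (third I J K) (half I J + ε I J + + K) (repr-even I J K))

    repr-sums : ∀ I J K → (total (repr I J K) ≡ 0ℤ) × (Q₁ (repr I J K) ≡ + I) × (Q₂ (repr I J K) ≡ + J) × (Q₃ (repr I J K) ≡ third I J K)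
    repr-sums I J K = proj₂ (realise (+ I) (+ J) (third I J K) (half I J + ε I J + + K) (repr-even I J K))

    total≡0⇒InK : ∀ x → total x ≡ 0ℤ → InK M x
    total≡0⇒InK x t = n , ℕ.>-nonZero⁻¹ n {{n≢0}} , lattice⇒InImL a b c (n ·V x)
      (trans (sumOver-· allV n x) (trans (cong (+ n *_) t) (*-zeroʳ (+ n))))
      (0ℤ , + βₙ * + γₙ * Q₁ x , + αₙ * + γₙ * Q₂ x , + αₙ * + βₙ * Q₃ x ,
       trans (sumOver-· coset₁ n x) (trans (cong (_* Q₁ x) n≡) (at₁ (+ αₙ) (+ βₙ) (+ γₙ) (Q₁ x))) ,
       trans (sumOver-· coset₂ n x) (trans (cong (_* Q₂ x) n≡) (at₂ (+ αₙ) (+ βₙ) (+ γₙ) (Q₂ x))) ,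
       trans (sumOver-· coset₃ n x) (trans (cong (_* Q₃ x) n≡) (at₃ (+ αₙ) (+ βₙ) (+ γₙ) (Q₃ x))))
      where
      n : ℕ
      n = 2 ℕ.* αₙ ℕ.* βₙ ℕ.* γₙ
      n≢0 : NonZero n
      n≢0 = ℕ.m*n≢0 (2 ℕ.* αₙ ℕ.* βₙ) γₙ {{ℕ.m*n≢0 (2 ℕ.* αₙ) βₙ {{ℕ.m*n≢0 2 αₙ}}}}
      n≡ : + n ≡ two * + αₙ * + βₙ * + γₙ
      n≡ = trans (pos-* (2 ℕ.* αₙ ℕ.* βₙ) γₙ) (cong (_* + γₙ) (trans (pos-* (2 ℕ.* αₙ) βₙ) (cong (_* + βₙ) (pos-* 2 αₙ))))
      at₁ : ∀ α β γ q → two * α * β * γ * q ≡ α * (0ℤ + two * (β * γ * q))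
      at₁ = solve-∀
      at₂ : ∀ α β γ q → two * α * β * γ * q ≡ β * (0ℤ + two * (α * γ * q))
      at₂ = solve-∀
      at₃ : ∀ α β γ q → two * α * β * γ * q ≡ γ * (0ℤ + two * (α * β * q))
      at₃ = solve-∀

    InK⇒total≡0 : ∀ x → InK M x → total x ≡ 0ℤ
    InK⇒total≡0 x (n , n≥1 , im) = *-cancelˡ-≡ (+ n) (total x) 0ℤ {{ℕ.>-nonZero n≥1}}
      (trans (sym (sumOver-· allV n x)) (trans (proj₁ (InImL⇒lattice a b c (n ·V x) im)) (sym (*-zeroʳ (+ n)))))

    private
      Q-diff : ∀ vs x y {r s} → sumOver vs x ≡ r → sumOver vs y ≡ s → sumOver vs (λ w → x w - y w) ≡ r - s
      Q-diff vs x y e f = trans (sumOver-diff vs x y) (cong₂ _-_ e f)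

    lattice⇒≈repr : ∀ x I J K → total x ≡ 0ℤ → Λ (+ I - Q₁ x) (+ J - Q₂ x) (third I J K - Q₃ x) → repr I J K ≈[ M ] x
    lattice⇒≈repr x I J K t l = let (t′ , q₁ , q₂ , q₃) = repr-sums I J K in
      lattice⇒InImL a b c _ (trans (Q-diff allV (repr I J K) x t′ t) (+-inverseʳ 0ℤ))
        (InLattice-≡ (+ αₙ) (+ βₙ) (+ γₙ) (sym (Q-diff coset₁ (repr I J K) x q₁ refl)) (sym (Q-diff coset₂ (repr I J K) x q₂ refl))
                     (sym (Q-diff coset₃ (repr I J K) x q₃ refl)) l)

    ≈repr : ∀ x → total x ≡ 0ℤ → Σ ℕ λ I → Σ ℕ λ J → Σ ℕ λ K →
            (I < αₙ) × (J < 2 ℕ.* βₙ) × (K < γₙ) × (repr I J K ≈[ M ] x)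
    ≈repr x t = let (I , J , K , I< , J< , K< , l) = representative (Q₁ x) (Q₂ x) (Q₃ x) (Q-sum-even x) in
      I , J , K , I< , J< , K< , lattice⇒≈repr x I J K t l

    repr-injective : ∀ {I J K I′ J′ K′} → I < αₙ → I′ < αₙ → J < 2 ℕ.* βₙ → J′ < 2 ℕ.* βₙ → K < γₙ → K′ < γₙ →
                     repr I J K ≈[ M ] repr I′ J′ K′ → (I ≡ I′) × (J ≡ J′) × (K ≡ K′)
    repr-injective {I} {J} {K} {I′} {J′} {K′} I< I′< J< J′< K< K′< r≈r′ =
      let (_ , q₁ , q₂ , q₃) = repr-sums I J K
          (_ , q₁′ , q₂′ , q₃′) = repr-sums I′ J′ K′
      in representative-unique I< I′< J< J′< K< K′< (InLattice-≡ (+ αₙ) (+ βₙ) (+ γₙ)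
           (Q-diff coset₁ (repr I J K) (repr I′ J′ K′) q₁ q₁′) (Q-diff coset₂ (repr I J K) (repr I′ J′ K′) q₂ q₂′)
           (Q-diff coset₃ (repr I J K) (repr I′ J′ K′) q₃ q₃′) (proj₂ (InImL⇒lattice a b c _ r≈r′)))

    cardK : CardK M (αₙ ℕ.* (2 ℕ.* βₙ ℕ.* γₙ))
    cardK = g , (λ i → total≡0⇒InK (g i) (total-g i)) , injective , surjective
      where
      g : Fin (αₙ ℕ.* (2 ℕ.* βₙ ℕ.* γₙ)) → ZV
      g i = let (I , J , K) = split₃ i in repr (toℕ I) (toℕ J) (toℕ K)

      total-g : ∀ i → total (g i) ≡ 0ℤ
      total-g i = let (I , J , K) = split₃ {αₙ} {2 ℕ.* βₙ} {γₙ} i in proj₁ (repr-sums (toℕ I) (toℕ J) (toℕ K))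

      injective : ∀ i j → g i ≈[ M ] g j → i ≡ j
      injective i j gi≈gj =
        let (I , J , K) = split₃ {αₙ} {2 ℕ.* βₙ} {γₙ} i ; (I′ , J′ , K′) = split₃ {αₙ} {2 ℕ.* βₙ} {γₙ} j
            (eI , eJ , eK) = repr-injective (toℕ<n I) (toℕ<n I′) (toℕ<n J) (toℕ<n J′) (toℕ<n K) (toℕ<n K′) gi≈gj
        in split₃-injective (cong₂ _,_ (toℕ-injective eI) (cong₂ _,_ (toℕ-injective eJ) (toℕ-injective eK)))

      surjective : ∀ x → InK M x → ∃ λ i → g i ≈[ M ] x
      surjective x x∈K =
        let (I , J , K , I< , J< , K< , r≈x) = ≈repr x (InK⇒total≡0 x x∈K)
            t = fromℕ< I< , fromℕ< J< , fromℕ< K<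
            gi≡ : g (join₃ t) ≡ repr I J K
            gi≡ = trans (cong (λ (I′ , J′ , K′) → repr (toℕ I′) (toℕ J′) (toℕ K′)) (split₃-join₃ t))
                        (trans (cong₂ (λ u v → repr u v (toℕ (fromℕ< K<))) (toℕ-fromℕ< I<) (toℕ-fromℕ< J<))
                               (cong (repr I J) (toℕ-fromℕ< K<)))
        in join₃ t , subst (_≈[ M ] x) (sym gi≡) r≈x

open Cardinality

module Exponents where

  open import Data.Nat as ℕ using (ℕ; zero; suc; _+_; _∸_; _^_; _⊔_; _≤_; _%_)
  import Data.Nat.Properties as ℕ
  open import Data.Nat.Tactic.RingSolver using () renaming (solve-∀ to ℕ-solve-∀)
  open import Data.Integer as ℤ using (+_)
  import Data.Integer.Properties as ℤ
  open import Data.Integer.Tactic.RingSolver using () renaming (solve-∀ to ℤ-solve-∀)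
  open import Data.Vec using (Vec; []; _∷_)
  open import Data.Product using (_,_)
  open import Data.Sum using (inj₁; inj₂)
  open import Relation.Binary.PropositionalEquality

  ordersFromMax : ℕ → ℕ → Vec ℕ 2
  ordersFromMax s m = 2 ^ (s ∸ (m + 1)) ∷ 2 ^ (m + 1) ∷ []

  -- s = v₂ |K(G)| and A, B, C are v₂ (a + c), v₂ (b + c), v₂ (a + b).
  factorOrders : ℕ → ℕ → ℕ → ℕ → Vec ℕ 2
  factorOrders s A B C = ordersFromMax s (C ⊔ B ⊔ A)

  -- |K(G)| = (a + c) · 2 (b + c) · (a + b) has 2-adic valuation A + (1 + B) + C.
  orders : ℕ → ℕ → ℕ → Vec ℕ 2
  orders A B C = factorOrders (A + (suc B + C)) A B C

  orders-swap₁₂ : ∀ A B C → orders A B C ≡ orders B A C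
  orders-swap₁₂ A B C = cong₂ ordersFromMax (sum≡ A B C)
    (trans (ℕ.⊔-assoc C B A) (trans (cong (C ⊔_) (ℕ.⊔-comm B A)) (sym (ℕ.⊔-assoc C A B))))
    where
    sum≡ : ∀ A B C → A + (suc B + C) ≡ B + (suc A + C)
    sum≡ = ℕ-solve-∀

  orders-swap₂₃ : ∀ A B C → orders A B C ≡ orders A C B
  orders-swap₂₃ A B C = cong₂ ordersFromMax (sum≡ A B C) (cong (_⊔ A) (ℕ.⊔-comm C B))
    where
    sum≡ : ∀ A B C → A + (suc B + C) ≡ A + (suc C + B)
    sum≡ = ℕ-solve-∀

  presentation-ones-≤ : ∀ {k l} → k ≤ l → Evenℤ (pow₂ k ℤ.+ pow₂ l) →
                        Presentation (pow₂ (suc k)) (pow₂ (suc l)) (pow₂ 1) (orders (suc k) (suc l) 1)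
  presentation-ones-≤ {k} {l} k≤l ev = subst (Presentation _ _ _) (sym orders≡) (bicyclic k l ev)
    where
    max≡ : l ⊔ k ≡ l
    max≡ = ℕ.m≥n⇒m⊔n≡m k≤l
    sum≡ : ∀ k l → suc k + (suc (suc l) + 1) ≡ (suc k + 1) + (suc l + 1)
    sum≡ = ℕ-solve-∀
    orders≡ : orders (suc k) (suc l) 1 ≡ 2 ^ (suc k + 1) ∷ 2 ^ (suc l + 1) ∷ []
    orders≡ = trans (cong (ordersFromMax (suc k + (suc (suc l) + 1))) (cong suc max≡))
      (cong (λ e → 2 ^ e ∷ 2 ^ (suc l + 1) ∷ []) (trans (cong (_∸ (suc l + 1)) (sum≡ k l)) (ℕ.m+n∸n≡m (suc k + 1) (suc l + 1))))

  presentation-ones : ∀ k l → Evenℤ (pow₂ k ℤ.+ pow₂ l) →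
                      Presentation (pow₂ (suc k)) (pow₂ (suc l)) (pow₂ 1) (orders (suc k) (suc l) 1)
  presentation-ones k l ev with ℕ.≤-total k l
  ... | inj₁ k≤l = presentation-ones-≤ k≤l ev
  ... | inj₂ l≤k = subst (Presentation _ _ _) (sym (orders-swap₁₂ (suc k) (suc l) 1))
    (presentation-swap₁₂ (presentation-ones-≤ l≤k (let (h , e) = ev in h , trans (ℤ.+-comm (pow₂ l) (pow₂ k)) e)))

  pow₂-suc-even : ∀ k l → Evenℤ (pow₂ (suc k) ℤ.+ pow₂ (suc l))
  pow₂-suc-even k l = pow₂ k ℤ.+ pow₂ l , trans (cong₂ ℤ._+_ (pow₂-suc k) (pow₂-suc l)) (lemma (pow₂ k) (pow₂ l))
    where
    lemma : ∀ x y → two ℤ.* x ℤ.+ two ℤ.* y ≡ (x ℤ.+ y) ℤ.+ (x ℤ.+ y)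
    lemma = ℤ-solve-∀

  -- The parity condition says that an odd number of the exponents suc A, suc B, suc C equal 1.
  presentation-allOdd : ∀ A B C → (pow2Parity A + pow2Parity B + pow2Parity C) % 2 ≡ 1 →
                        Presentation (pow₂ (suc A)) (pow₂ (suc B)) (pow₂ (suc C)) (orders (suc A) (suc B) (suc C))
  presentation-allOdd zero zero zero _ = presentation-ones 0 0 (+ 1 , refl)
  presentation-allOdd zero (suc B) (suc C) _ =
    subst (Presentation _ _ _) (trans (orders-swap₂₃ (2 + B) (2 + C) 1) (orders-swap₁₂ (2 + B) 1 (2 + C)))
      (presentation-swap₁₂ (presentation-swap₂₃ (presentation-ones (suc B) (suc C) (pow₂-suc-even B C))))
  presentation-allOdd (suc A) zero (suc C) _ =
    subst (Presentation _ _ _) (orders-swap₂₃ (2 + A) (2 + C) 1)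
      (presentation-swap₂₃ (presentation-ones (suc A) (suc C) (pow₂-suc-even A C)))
  presentation-allOdd (suc A) (suc B) zero _ = presentation-ones (suc A) (suc B) (pow₂-suc-even A B)
  presentation-allOdd zero zero (suc C) ()
  presentation-allOdd zero (suc B) zero ()
  presentation-allOdd (suc A) zero zero ()
  presentation-allOdd (suc A) (suc B) (suc C) ()

open Exponents

module Cases where

  open import Data.Bool using (false; true)
  open import Data.Nat as ℕ using (ℕ; zero; suc; _+_; _*_; _%_; _^_; NonZero; ≢-nonZero)
  import Data.Nat.Properties as ℕ
  open import Data.Nat.Tactic.RingSolver using () renaming (solve-∀ to ℕ-solve-∀)
  open import Data.List using ([]; _∷_; _++_; replicate)
  open import Data.Vec using ([]; _∷_)
  open import Data.Product using (∃; _×_; _,_; proj₂)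
  open import Relation.Binary.PropositionalEquality

  private
    lincomb-horizontal : ∀ s a → proj₂ (lincomb s (replicate a v₁₀ ++ [])) ≡ false
    lincomb-horizontal [] zero = refl
    lincomb-horizontal [] (suc a) = refl
    lincomb-horizontal (true ∷ _) zero = refl
    lincomb-horizontal (false ∷ _) zero = refl
    lincomb-horizontal (true ∷ s) (suc a) = lincomb-horizontal s a
    lincomb-horizontal (false ∷ s) (suc a) = lincomb-horizontal s a

  Generates⇒b+c≢0 : ∀ a b c → Generates (Mabc a b c) → b + c ≢ 0
  Generates⇒b+c≢0 a zero zero gen _ with gen v₀₁
  ... | s , _ , lincomb≡v₀₁ with trans (sym (lincomb-horizontal s a)) (cong proj₂ lincomb≡v₀₁)
  ... | ()

  halves-parity : ∀ a b c {A B C} → a % 2 ≡ 1 → b % 2 ≡ 1 → c % 2 ≡ 1 →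
                  a + c ≡2^ suc A *odd → b + c ≡2^ suc B *odd → a + b ≡2^ suc C *odd →
                  (pow2Parity A + pow2Parity B + pow2Parity C) % 2 ≡ 1
  halves-parity a b c {A} {B} {C} a-odd b-odd c-odd (h₁ , e₁) (h₂ , e₂) (h₃ , e₃) = begin
    (pow2Parity A + pow2Parity B + pow2Parity C) % 2
      ≡⟨ %2-cong-+ (H₁ + H₂) (pow2Parity A + pow2Parity B) H₃ (pow2Parity C) (%2-cong-+ H₁ (pow2Parity A) H₂ (pow2Parity B) (2^k*odd%2 A h₁) (2^k*odd%2 B h₂))
                    (2^k*odd%2 C h₃) ⟨
    (H₁ + H₂ + H₃) % 2  ≡⟨ cong (_% 2) halves-sum ⟩
    (a + b + c) % 2     ≡⟨ %2-cong-+ (a + b) 2 c 1 (%2-cong-+ a 1 b 1 a-odd b-odd) c-odd ⟩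
    1                   ∎
    where
    open ≡-Reasoning
    H₁ H₂ H₃ : ℕ
    H₁ = 2 ^ A * suc (h₁ + h₁)
    H₂ = 2 ^ B * suc (h₂ + h₂)
    H₃ = 2 ^ C * suc (h₃ + h₃)
    twice : ∀ k h → 2 * (2 ^ k * suc (h + h)) ≡ 2 ^ suc k * suc (h + h)
    twice k h = sym (ℕ.*-assoc 2 (2 ^ k) (suc (h + h)))
    halves-sum : H₁ + H₂ + H₃ ≡ a + b + c
    halves-sum = ℕ.*-cancelˡ-≡ (H₁ + H₂ + H₃) (a + b + c) 2 (begin
      2 * (H₁ + H₂ + H₃)                  ≡⟨ distrib H₁ H₂ H₃ ⟩
      2 * H₁ + 2 * H₂ + 2 * H₃            ≡⟨ cong₂ _+_ (cong₂ _+_ (trans (twice A h₁) (sym e₁)) (trans (twice B h₂) (sym e₂)))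
                                                         (trans (twice C h₃) (sym e₃)) ⟩
      (a + c) + (b + c) + (a + b)         ≡⟨ regroup a b c ⟩
      2 * (a + b + c)                     ∎)
      where
      distrib : ∀ x y z → 2 * (x + y + z) ≡ 2 * x + 2 * y + 2 * z
      distrib = ℕ-solve-∀
      regroup : ∀ a b c → (a + c) + (b + c) + (a + b) ≡ 2 * (a + b + c)
      regroup = ℕ-solve-∀

  case₁ : ∀ a b c → Generates (Mabc a b c) → a % 2 ≡ 1 → b % 2 ≡ 0 → c % 2 ≡ 0 →
          Syl2Iso (Mabc a b c) (2 ^ (v₂ (b + c) + 1) ∷ [])
  case₁ a b c gen a-odd b-even c-even = from (even⇒≡2^suc*odd (even+even eb ec))
    where
    oa : Odd a
    oa = %2≡1⇒odd a a-odd
    eb : Even b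
    eb = %2≡0⇒even b b-even
    ec : Even c
    ec = %2≡0⇒even c c-even
    instance
      b+c≢0 : NonZero (b + c)
      b+c≢0 = ≢-nonZero (Generates⇒b+c≢0 a b c gen)
    from : (∃ λ B → b + c ≡2^ suc B *odd) → Syl2Iso (Mabc a b c) (2 ^ (v₂ (b + c) + 1) ∷ [])
    from (B , bc) = subst (λ k → Syl2Iso (Mabc a b c) (2 ^ (k + 1) ∷ [])) (sym (v₂-≡2^*odd bc))
      (presentation⇒Syl2Iso a b c (odd⇒≡2^0*odd (odd+even oa ec)) bc (odd⇒≡2^0*odd (odd+even oa eb)) (cyclic B))

  case₂ : ∀ a b c → a % 2 ≡ 1 → b % 2 ≡ 1 → c % 2 ≡ 0 → Syl2Iso (Mabc a b c) (2 ^ (v₂ (a + b) + 1) ∷ [])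
  case₂ a b c a-odd b-odd c-even = from (even⇒≡2^suc*odd (odd+odd oa ob))
    where
    oa : Odd a
    oa = %2≡1⇒odd a a-odd
    ob : Odd b
    ob = %2≡1⇒odd b b-odd
    ec : Even c
    ec = %2≡0⇒even c c-even
    instance
      a+b≢0 : NonZero (a + b)
      a+b≢0 = odd⇒nonZero+ oa
    from : (∃ λ C → a + b ≡2^ suc C *odd) → Syl2Iso (Mabc a b c) (2 ^ (v₂ (a + b) + 1) ∷ [])
    from (C , ab) = subst (λ k → Syl2Iso (Mabc a b c) (2 ^ (k + 1) ∷ [])) (sym (v₂-≡2^*odd ab))
      (presentation⇒Syl2Iso a b c (odd⇒≡2^0*odd (odd+even oa ec)) (odd⇒≡2^0*odd (odd+even ob ec)) ab
        (presentation-swap₂₃ (cyclic C)))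

  case₃ : ∀ a b c → a % 2 ≡ 1 → b % 2 ≡ 1 → c % 2 ≡ 1 → ∃ λ N → CardK (Mabc a b c) N ×
          Syl2Iso (Mabc a b c) (factorOrders (v₂ N) (v₂ (a + c)) (v₂ (b + c)) (v₂ (a + b)))
  case₃ a b c a-odd b-odd c-odd =
    from (even⇒≡2^suc*odd (odd+odd oa oc)) (even⇒≡2^suc*odd (odd+odd ob oc)) (even⇒≡2^suc*odd (odd+odd oa ob))
    where
    oa : Odd a
    oa = %2≡1⇒odd a a-odd
    ob : Odd b
    ob = %2≡1⇒odd b b-odd
    oc : Odd c
    oc = %2≡1⇒odd c c-odd
    instance
      a+c≢0 : NonZero (a + c)
      a+c≢0 = odd⇒nonZero+ oa
      b+c≢0 : NonZero (b + c)
      b+c≢0 = odd⇒nonZero+ ob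
      a+b≢0 : NonZero (a + b)
      a+b≢0 = odd⇒nonZero+ oa
    from : (∃ λ A → a + c ≡2^ suc A *odd) → (∃ λ B → b + c ≡2^ suc B *odd) → (∃ λ C → a + b ≡2^ suc C *odd) →
           ∃ λ N → CardK (Mabc a b c) N × Syl2Iso (Mabc a b c) (factorOrders (v₂ N) (v₂ (a + c)) (v₂ (b + c)) (v₂ (a + b)))
    from (A , ac) (B , bc) (C , ab) = N , cardK a b c ,
      subst (Syl2Iso (Mabc a b c)) orders≡
        (presentation⇒Syl2Iso a b c ac bc ab (presentation-allOdd A B C (halves-parity a b c a-odd b-odd c-odd ac bc ab)))
      where
      N : ℕ
      N = (a + c) * (2 * (b + c) * (a + b))
      orders≡ : orders (suc A) (suc B) (suc C) ≡ factorOrders (v₂ N) (v₂ (a + c)) (v₂ (b + c)) (v₂ (a + b))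
      orders≡ = sym (trans
        (cong₂ (λ s A′ → factorOrders s A′ (v₂ (b + c)) (v₂ (a + b)))
               (v₂-≡2^*odd (*-≡2^*odd ac (*-≡2^*odd (2*-≡2^*odd bc) ab))) (v₂-≡2^*odd ac))
        (cong₂ (factorOrders (suc A + (suc (suc B) + suc C)) (suc A)) (v₂-≡2^*odd bc) (v₂-≡2^*odd ab)))

open Cases

open import Data.Nat using (ℕ; _+_; _∸_; _%_; _^_; _⊔_)
open import Data.Nat.GCD using (gcd)
open import Data.Product using (∃; _×_; _,_)
open import Data.Vec using ([]; _∷_)
open import Relation.Binary.PropositionalEquality using (_≡_)

mainTheorem14 : (a b c : ℕ) → gcd (gcd a b) c ≡ 1 → Generates (Mabc a b c) →
    (a % 2 ≡ 1 → b % 2 ≡ 0 → c % 2 ≡ 0 →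
      Syl2Iso (Mabc a b c) (2 ^ (v₂ (b + c) + 1) ∷ []))
  × (a % 2 ≡ 1 → b % 2 ≡ 1 → c % 2 ≡ 0 →
      Syl2Iso (Mabc a b c) (2 ^ (v₂ (a + b) + 1) ∷ []))
  × (a % 2 ≡ 1 → b % 2 ≡ 1 → c % 2 ≡ 1 →
      ∃ λ (N : ℕ) → CardK (Mabc a b c) N
        × Syl2Iso (Mabc a b c)
            (2 ^ (v₂ N ∸ ((v₂ (a + b) ⊔ v₂ (b + c) ⊔ v₂ (a + c)) + 1))
              ∷ 2 ^ ((v₂ (a + b) ⊔ v₂ (b + c) ⊔ v₂ (a + c)) + 1) ∷ []))
mainTheorem14 a b c _ generates = case₁ a b c generates , case₂ a b c , case₃ a b c
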